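{- For all terms $s,t$ over $\Sigma_{CP}(A)$ with variables, if $\mathrm{CP}_{mem}\vdash s=t$ then $\mathrm{EqMSCL}\vdash g(s)=g(t)$.
   Context: $A$ is a non-empty set of atoms. $\Sigma_{SCL}(A)=\{\land_s,\lor_s,\neg,\mathsf T,\mathsf F\}\cup A$; $\Sigma_{CP}(A)=\{\_\lhd\_\rhd\_,\mathsf T,\mathsf F\}\cup A$ with $x\lhd y\rhd z$ Hoare's conditional. $\mathrm{CP}_{mem}$ consists of (CP1) $x\lhd\mathsf T\rhd y=x$, (CP2) $x\lhd\mathsf F\rhd y=y$, (CP3) $\mathsf T\lhd x\rhd\mathsf F=x$, (CP4) $x\lhd(y\lhd z\rhd u)\rhd v=(x\lhd y\rhd v)\lhd z\rhd(x\lhd u\rhd v)$, (CPmem) $x\lhd y\rhd(z\lhd u\rhd(v\lhd y\rhd w))=x\lhd y\rhd(z\lhd u\rhd w)$. $\mathrm{EqMSCL}$ consists of (Neg) $\mathsf F=\neg\mathsf T$, (Or) $x\lor_s y=\neg(\neg x\land_s\neg y)$, (Tand) $\mathsf T\land_s x=x$, (Abs) $x\land_s(x\lor_s y)=x$, (Mem) $(x\lor_s y)\land_s z=(\neg x\land_s(y\land_s z))\lor_s(x\land_s z)$. $\vdash$ is equational-logic derivability. The map $g$ from terms over $\Sigma_{CP}(A)$ to terms over $\Sigma_{SCL}(A)$ is given by $g(\mathsf T)=\mathsf T$, $g(\mathsf F)=\mathsf F$, $g(a)=a$ ($a\in A$), $g(x)=x$ (variables), $g(t_1\lhd t_2\rhd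 t_3)=(g(t_2)\land_s g(t_1))\lor_s(\neg g(t_2)\land_s g(t_3))$. -}

module Defs where

open import Data.Nat using (ℕ)

Var : Set
Var = ℕ

data CPTerm (A : Set) : Set where
  var  : Var → CPTerm A
  atom : A → CPTerm A
  T F  : CPTerm A
  _◁_▷_ : CPTerm A → CPTerm A → CPTerm A → CPTerm A

data SCLTerm (A : Set) : Set where
  var  : Var → SCLTerm A
  atom : A → SCLTerm A
  T F  : SCLTerm A
  _∧s_ _∨s_ : SCLTerm A → SCLTerm A → SCLTerm A
  ¬s_  : SCLTerm A → SCLTerm A

substCP : {A : Set} → (Var → CPTerm A) → CPTerm A → CPTerm A
substCP σ (var x) = σ x
substCP σ (atom a) = atom a
substCP σ T = T
substCP σ F = F
substCP σ (t₁ ◁ t₂ ▷ t₃) = substCP σ t₁ ◁ substCP σ t₂ ▷ substCP σ t₃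

substSCL : {A : Set} → (Var → SCLTerm A) → SCLTerm A → SCLTerm A
substSCL σ (var x) = σ x
substSCL σ (atom a) = atom a
substSCL σ T = T
substSCL σ F = F
substSCL σ (t ∧s u) = substSCL σ t ∧s substSCL σ u
substSCL σ (t ∨s u) = substSCL σ t ∨s substSCL σ u
substSCL σ (¬s t) = ¬s substSCL σ t

module _ {A : Set} where
  private
    x y z u v w : CPTerm A
    x = var 0
    y = var 1
    z = var 2
    u = var 3
    v = var 4
    w = var 5

  data CPmemAxiom : CPTerm A → CPTerm A → Set where
    CP1   : CPmemAxiom (x ◁ T ▷ y) x
    CP2   : CPmemAxiom (x ◁ F ▷ y) y
    CP3   : CPmemAxiom (T ◁ x ▷ F) x
    CP4   : CPmemAxiom (x ◁ (y ◁ z ▷ u) ▷ v) ((x ◁ y ▷ v) ◁ z ▷ (x ◁ u ▷ v))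
    CPmem : CPmemAxiom (x ◁ y ▷ (z ◁ u ▷ (v ◁ y ▷ w))) (x ◁ y ▷ (z ◁ u ▷ w))

module _ {A : Set} where
  private
    x y z : SCLTerm A
    x = var 0
    y = var 1
    z = var 2

  data EqMSCLAxiom : SCLTerm A → SCLTerm A → Set where
    Neg  : EqMSCLAxiom F (¬s T)
    Or   : EqMSCLAxiom (x ∨s y) (¬s ((¬s x) ∧s (¬s y)))
    Tand : EqMSCLAxiom (T ∧s x) x
    Abs  : EqMSCLAxiom (x ∧s (x ∨s y)) x
    Mem  : EqMSCLAxiom ((x ∨s y) ∧s z) (((¬s x) ∧s (y ∧s z)) ∨s (x ∧s z))

data CPmem⊢_≈_ {A : Set} : CPTerm A → CPTerm A → Set where
  ax    : ∀ {l r} (σ : Var → CPTerm A) → CPmemAxiom l r →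
          CPmem⊢ substCP σ l ≈ substCP σ r
  refl  : ∀ {t} → CPmem⊢ t ≈ t
  sym   : ∀ {s t} → CPmem⊢ s ≈ t → CPmem⊢ t ≈ s
  trans : ∀ {s t u} → CPmem⊢ s ≈ t → CPmem⊢ t ≈ u → CPmem⊢ s ≈ u
  cong◁▷ : ∀ {s₁ s₂ s₃ t₁ t₂ t₃} → CPmem⊢ s₁ ≈ t₁ → CPmem⊢ s₂ ≈ t₂ →
           CPmem⊢ s₃ ≈ t₃ → CPmem⊢ (s₁ ◁ s₂ ▷ s₃) ≈ (t₁ ◁ t₂ ▷ t₃)

data EqMSCL⊢_≈_ {A : Set} : SCLTerm A → SCLTerm A → Set where
  ax    : ∀ {l r} (σ : Var → SCLTerm A) → EqMSCLAxiom l r →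
          EqMSCL⊢ substSCL σ l ≈ substSCL σ r
  refl  : ∀ {t} → EqMSCL⊢ t ≈ t
  sym   : ∀ {s t} → EqMSCL⊢ s ≈ t → EqMSCL⊢ t ≈ s
  trans : ∀ {s t u} → EqMSCL⊢ s ≈ t → EqMSCL⊢ t ≈ u → EqMSCL⊢ s ≈ u
  cong∧ : ∀ {s₁ s₂ t₁ t₂} → EqMSCL⊢ s₁ ≈ t₁ → EqMSCL⊢ s₂ ≈ t₂ →
          EqMSCL⊢ (s₁ ∧s s₂) ≈ (t₁ ∧s t₂)
  cong∨ : ∀ {s₁ s₂ t₁ t₂} → EqMSCL⊢ s₁ ≈ t₁ → EqMSCL⊢ s₂ ≈ t₂ →
          EqMSCL⊢ (s₁ ∨s s₂) ≈ (t₁ ∨s t₂)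
  cong¬ : ∀ {s t} → EqMSCL⊢ s ≈ t → EqMSCL⊢ (¬s s) ≈ (¬s t)

g : {A : Set} → CPTerm A → SCLTerm A
g (var x) = var x
g (atom a) = atom a
g T = T
g F = F
g (t₁ ◁ t₂ ▷ t₃) = (g t₂ ∧s g t₁) ∨s ((¬s g t₂) ∧s g t₃)

-- g sends Hoare's conditional x ◁ y ▷ z to (y ∧ x) ∨ (¬ y ∧ z), written x ◂ y ▸ z below, and g is
-- compositional, so it suffices that g maps every instance of a CP_mem axiom to an EqMSCL equation.
-- The key facts are y ∧ (x ◂ y ▸ z) = y ∧ x and ¬ y ∧ (x ◂ y ▸ z) = ¬ y ∧ z: once its guard is
-- known, a conditional reduces to one of its branches.  From them, the conditional commutes with ¬,
-- with ∧ on the right and with ∨ of two conditionals on the same guard, giving CP4, while CPmem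
-- reduces to the memorizing law x ∧ y ∧ x ∧ z = x ∧ y ∧ z.  The underlying EqMSCL laws (double
-- negation, associativity of ∧, distributivity of ∧ over ∨, ...) are reached by long equational
-- chains found by automated proof search.

module Submission where

open import Data.Nat using (suc)
open import Level using (0ℓ)
open import Relation.Binary.Bundles using (Setoid)
open import Defs

module _ {A : Set} where

  infixr 40 ¬_
  infixr 35 _∧_
  infixr 30 _∨_

  pattern ¬_ x = ¬s x
  pattern _∧_ x y = x ∧s y
  pattern _∨_ x y = x ∨s y

  variable
    x y z u v w : SCLTerm A

  EqMSCL-setoid : Setoid 0ℓ 0ℓ
  EqMSCL-setoid = record
    { Carrier       = SCLTerm A
    ; _≈_           = EqMSCL⊢_≈_
    ; isEquivalence = record { refl = refl ; sym = sym ; trans = trans }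
    }

  open import Relation.Binary.Reasoning.Setoid EqMSCL-setoid

  ∧-congˡ : EqMSCL⊢ y ≈ z → EqMSCL⊢ x ∧ y ≈ x ∧ z
  ∧-congˡ = cong∧ refl

  ∧-congʳ : EqMSCL⊢ x ≈ y → EqMSCL⊢ x ∧ z ≈ y ∧ z
  ∧-congʳ p = cong∧ p refl

  ∨-congˡ : EqMSCL⊢ y ≈ z → EqMSCL⊢ x ∨ y ≈ x ∨ z
  ∨-congˡ = cong∨ refl

  ∨-congʳ : EqMSCL⊢ x ≈ y → EqMSCL⊢ x ∨ z ≈ y ∨ z
  ∨-congʳ p = cong∨ p refl

  [_,_,_] : SCLTerm A → SCLTerm A → SCLTerm A → Var → SCLTerm A
  [ a , b , c ] 0             = a
  [ a , b , c ] 1             = b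
  [ a , b , c ] (suc (suc _)) = c

  F≈¬T : EqMSCL⊢ F ≈ ¬ T
  F≈¬T = ax [ T , T , T ] Neg

  ∨-def : EqMSCL⊢ x ∨ y ≈ ¬ (¬ x ∧ ¬ y)
  ∨-def {x} {y} = ax [ x , y , T ] Or

  ∧-identityˡ : EqMSCL⊢ T ∧ x ≈ x
  ∧-identityˡ {x} = ax [ x , T , T ] Tand

  ∧-absorbs-∨ : EqMSCL⊢ x ∧ (x ∨ y) ≈ x
  ∧-absorbs-∨ {x} {y} = ax [ x , y , T ] Abs

  mem-distribʳ : EqMSCL⊢ (x ∨ y) ∧ z ≈ (¬ x ∧ y ∧ z) ∨ (x ∧ z)
  mem-distribʳ {x} {y} {z} = ax [ x , y , z ] Mem

  ∨-zeroˡ : EqMSCL⊢ T ∨ x ≈ T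
  ∨-zeroˡ {x} = begin
    T ∨ x        ≈⟨ ∧-identityˡ ⟨
    T ∧ (T ∨ x)  ≈⟨ ∧-absorbs-∨ ⟩
    T            ∎

  x∧¬[¬x∧¬y]≈x : EqMSCL⊢ x ∧ ¬ (¬ x ∧ ¬ y) ≈ x
  x∧¬[¬x∧¬y]≈x {x} {y} = begin
    x ∧ ¬ (¬ x ∧ ¬ y)  ≈⟨ ∧-congˡ ∨-def ⟨
    x ∧ (x ∨ y)        ≈⟨ ∧-absorbs-∨ ⟩
    x                  ∎

  ¬F≈T : EqMSCL⊢ ¬ F ≈ T
  ¬F≈T = begin
    ¬ F                      ≈⟨ cong¬ x∧¬[¬x∧¬y]≈x ⟨
    ¬ (F ∧ ¬ (¬ F ∧ ¬ T))    ≈⟨ cong¬ (∧-congʳ F≈¬T) ⟩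
    ¬ (¬ T ∧ ¬ (¬ F ∧ ¬ T))  ≈⟨ ∨-def ⟨
    T ∨ (¬ F ∧ ¬ T)          ≈⟨ ∨-zeroˡ ⟩
    T                        ∎

  F∧¬¬x≈F : EqMSCL⊢ F ∧ ¬ ¬ x ≈ F
  F∧¬¬x≈F {x} = begin
    F ∧ ¬ ¬ x          ≈⟨ ∧-congˡ (cong¬ ∧-identityˡ) ⟨
    F ∧ ¬ (T ∧ ¬ x)    ≈⟨ ∧-congˡ (cong¬ (∧-congʳ ¬F≈T)) ⟨
    F ∧ ¬ (¬ F ∧ ¬ x)  ≈⟨ ∧-congˡ ∨-def ⟨
    F ∧ (F ∨ x)        ≈⟨ ∧-absorbs-∨ ⟩
    F                  ∎

  -- Mem at x = T: every term is a negation, which is the way to F ∧ x ≈ F and ¬ ¬ x ≈ x.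
  [F∧y∧x]∨x≈x : EqMSCL⊢ (F ∧ y ∧ x) ∨ x ≈ x
  [F∧y∧x]∨x≈x {y} {x} = begin
    (F ∧ y ∧ x) ∨ x          ≈⟨ ∨-congʳ (∧-congʳ F≈¬T) ⟩
    (¬ T ∧ y ∧ x) ∨ x        ≈⟨ ∨-congˡ ∧-identityˡ ⟨
    (¬ T ∧ y ∧ x) ∨ (T ∧ x)  ≈⟨ mem-distribʳ ⟨
    (T ∨ y) ∧ x              ≈⟨ ∧-congʳ ∨-zeroˡ ⟩
    T ∧ x                    ≈⟨ ∧-identityˡ ⟩
    x                        ∎

  ¬[¬[¬x∧y∧z]∧¬[x∧z]]≈¬[¬x∧¬y]∧z : EqMSCL⊢ ¬ (¬ (¬ x ∧ y ∧ z) ∧ ¬ (x ∧ z)) ≈ ¬ (¬ x ∧ ¬ y) ∧ z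
  ¬[¬[¬x∧y∧z]∧¬[x∧z]]≈¬[¬x∧¬y]∧z {x} {y} {z} = begin
    ¬ (¬ (¬ x ∧ y ∧ z) ∧ ¬ (x ∧ z))  ≈⟨ ∨-def ⟨
    (¬ x ∧ y ∧ z) ∨ (x ∧ z)          ≈⟨ mem-distribʳ ⟨
    (x ∨ y) ∧ z                      ≈⟨ ∧-congʳ ∨-def ⟩
    ¬ (¬ x ∧ ¬ y) ∧ z                ∎

  F∧¬x≈F : EqMSCL⊢ F ∧ ¬ x ≈ F
  F∧¬x≈F {x} = begin
    F ∧ ¬ x                        ≈⟨ ∧-congˡ (cong¬ [F∧y∧x]∨x≈x) ⟨
    F ∧ ¬ ((F ∧ T ∧ x) ∨ x)        ≈⟨ ∧-congˡ (cong¬ ∨-def) ⟩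
    F ∧ ¬ ¬ (¬ (F ∧ T ∧ x) ∧ ¬ x)  ≈⟨ F∧¬¬x≈F ⟩
    F                              ∎

  ∧-zeroˡ : EqMSCL⊢ F ∧ x ≈ F
  ∧-zeroˡ {x} = begin
    F ∧ x                        ≈⟨ ∧-congˡ [F∧y∧x]∨x≈x ⟨
    F ∧ ((F ∧ T ∧ x) ∨ x)        ≈⟨ ∧-congˡ ∨-def ⟩
    F ∧ ¬ (¬ (F ∧ T ∧ x) ∧ ¬ x)  ≈⟨ F∧¬x≈F ⟩
    F                            ∎

  F∨x≈x : EqMSCL⊢ F ∨ x ≈ x
  F∨x≈x {x} = begin
    F ∨ x            ≈⟨ ∨-congʳ ∧-zeroˡ ⟨
    (F ∧ T ∧ x) ∨ x  ≈⟨ [F∧y∧x]∨x≈x ⟩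
    x                ∎

  x∨F≈x : EqMSCL⊢ x ∨ F ≈ x
  x∨F≈x {x} = begin
    x ∨ F                    ≈⟨ ∨-congʳ ∧-identityˡ ⟨
    (T ∧ x) ∨ F              ≈⟨ ∨-congʳ (∧-congˡ ∧-identityˡ) ⟨
    (T ∧ T ∧ x) ∨ F          ≈⟨ ∨-congˡ ∧-zeroˡ ⟨
    (T ∧ T ∧ x) ∨ (F ∧ x)    ≈⟨ ∨-congʳ (∧-congʳ ¬F≈T) ⟨
    (¬ F ∧ T ∧ x) ∨ (F ∧ x)  ≈⟨ mem-distribʳ ⟨
    (F ∨ T) ∧ x              ≈⟨ ∧-congʳ F∨x≈x ⟩
    T ∧ x                    ≈⟨ ∧-identityˡ ⟩
    x                        ∎

  ¬[¬x∧T]≈x : EqMSCL⊢ ¬ (¬ x ∧ T) ≈ x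
  ¬[¬x∧T]≈x {x} = begin
    ¬ (¬ x ∧ T)    ≈⟨ cong¬ (∧-congˡ ¬F≈T) ⟨
    ¬ (¬ x ∧ ¬ F)  ≈⟨ ∨-def ⟨
    x ∨ F          ≈⟨ x∨F≈x ⟩
    x              ∎

  ¬-involutive : EqMSCL⊢ ¬ ¬ x ≈ x
  ¬-involutive {x} = begin
    ¬ ¬ x          ≈⟨ cong¬ ∧-identityˡ ⟨
    ¬ (T ∧ ¬ x)    ≈⟨ cong¬ (∧-congʳ ¬F≈T) ⟨
    ¬ (¬ F ∧ ¬ x)  ≈⟨ ∨-def ⟨
    F ∨ x          ≈⟨ F∨x≈x ⟩
    x              ∎

  ∧-identityʳ : EqMSCL⊢ x ∧ T ≈ x
  ∧-identityʳ {x} = begin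
    x ∧ T            ≈⟨ ¬-involutive ⟨
    ¬ ¬ (x ∧ T)      ≈⟨ cong¬ (cong¬ (∧-congʳ ¬-involutive)) ⟨
    ¬ ¬ (¬ ¬ x ∧ T)  ≈⟨ cong¬ ¬[¬x∧T]≈x ⟩
    ¬ ¬ x            ≈⟨ ¬-involutive ⟩
    x                ∎

  x∧¬[¬x∧y]≈x : EqMSCL⊢ x ∧ ¬ (¬ x ∧ y) ≈ x
  x∧¬[¬x∧y]≈x {x} {y} = begin
    x ∧ ¬ (¬ x ∧ y)      ≈⟨ ∧-congˡ (cong¬ (∧-congˡ ¬-involutive)) ⟨
    x ∧ ¬ (¬ x ∧ ¬ ¬ y)  ≈⟨ x∧¬[¬x∧¬y]≈x ⟩
    x                    ∎

  ∧-idem : EqMSCL⊢ x ∧ x ≈ x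
  ∧-idem {x} = begin
    x ∧ x            ≈⟨ ∧-congˡ ¬[¬x∧T]≈x ⟨
    x ∧ ¬ (¬ x ∧ T)  ≈⟨ x∧¬[¬x∧y]≈x ⟩
    x                ∎

  ¬x∧¬[x∧y]≈¬x : EqMSCL⊢ ¬ x ∧ ¬ (x ∧ y) ≈ ¬ x
  ¬x∧¬[x∧y]≈¬x {x} {y} = begin
    ¬ x ∧ ¬ (x ∧ y)      ≈⟨ ∧-congˡ (cong¬ (∧-congʳ ¬-involutive)) ⟨
    ¬ x ∧ ¬ (¬ ¬ x ∧ y)  ≈⟨ x∧¬[¬x∧y]≈x ⟩
    ¬ x                  ∎

  ¬[¬[¬x∧y]∧¬[x∧y]]≈¬[¬x∧F]∧y : EqMSCL⊢ ¬ (¬ (¬ x ∧ y) ∧ ¬ (x ∧ y)) ≈ ¬ (¬ x ∧ F) ∧ y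
  ¬[¬[¬x∧y]∧¬[x∧y]]≈¬[¬x∧F]∧y {x} {y} = begin
    ¬ (¬ (¬ x ∧ y) ∧ ¬ (x ∧ y))      ≈⟨ cong¬ (∧-congʳ (cong¬ (∧-congˡ ∧-identityˡ))) ⟨
    ¬ (¬ (¬ x ∧ T ∧ y) ∧ ¬ (x ∧ y))  ≈⟨ ¬[¬[¬x∧y∧z]∧¬[x∧z]]≈¬[¬x∧¬y]∧z ⟩
    ¬ (¬ x ∧ ¬ T) ∧ y                ≈⟨ ∧-congʳ (cong¬ (∧-congˡ F≈¬T)) ⟨
    ¬ (¬ x ∧ F) ∧ y                  ∎

  x∧¬[x∧F]≈x : EqMSCL⊢ x ∧ ¬ (x ∧ F) ≈ x
  x∧¬[x∧F]≈x {x} = begin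
    x ∧ ¬ (x ∧ F)                                  ≈⟨ ∧-congˡ (cong¬ (∧-congʳ ¬-involutive)) ⟨
    x ∧ ¬ (¬ ¬ x ∧ F)                              ≈⟨ ∧-congʳ ¬-involutive ⟨
    ¬ ¬ x ∧ ¬ (¬ ¬ x ∧ F)                          ≈⟨ ∧-congˡ ∧-identityʳ ⟨
    ¬ ¬ x ∧ ¬ (¬ ¬ x ∧ F) ∧ T                      ≈⟨ ∧-congʳ ∧-identityʳ ⟨
    (¬ ¬ x ∧ T) ∧ ¬ (¬ ¬ x ∧ F) ∧ T                ≈⟨ ∧-congˡ ¬[¬[¬x∧y]∧¬[x∧y]]≈¬[¬x∧F]∧y ⟨
    (¬ ¬ x ∧ T) ∧ ¬ (¬ (¬ ¬ x ∧ T) ∧ ¬ (¬ x ∧ T))  ≈⟨ x∧¬[¬x∧y]≈x ⟩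
    ¬ ¬ x ∧ T                                      ≈⟨ ∧-identityʳ ⟩
    ¬ ¬ x                                          ≈⟨ ¬-involutive ⟩
    x                                              ∎

  ¬[¬x∧F]≈¬[x∧¬x] : EqMSCL⊢ ¬ (¬ x ∧ F) ≈ ¬ (x ∧ ¬ x)
  ¬[¬x∧F]≈¬[x∧¬x] {x} = begin
    ¬ (¬ x ∧ F)                  ≈⟨ ∧-identityʳ ⟨
    ¬ (¬ x ∧ F) ∧ T              ≈⟨ ¬[¬[¬x∧y]∧¬[x∧y]]≈¬[¬x∧F]∧y ⟨
    ¬ (¬ (¬ x ∧ T) ∧ ¬ (x ∧ T))  ≈⟨ cong¬ (∧-congʳ ¬[¬x∧T]≈x) ⟩
    ¬ (x ∧ ¬ (x ∧ T))            ≈⟨ cong¬ (∧-congˡ (cong¬ ∧-identityʳ)) ⟩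
    ¬ (x ∧ ¬ x)                  ∎

  ¬x∧F≈x∧¬x : EqMSCL⊢ ¬ x ∧ F ≈ x ∧ ¬ x
  ¬x∧F≈x∧¬x {x} = begin
    ¬ x ∧ F        ≈⟨ ¬-involutive ⟨
    ¬ ¬ (¬ x ∧ F)  ≈⟨ cong¬ ¬[¬x∧F]≈¬[x∧¬x] ⟩
    ¬ ¬ (x ∧ ¬ x)  ≈⟨ ¬-involutive ⟩
    x ∧ ¬ x        ∎

  ¬x∧x≈x∧F : EqMSCL⊢ ¬ x ∧ x ≈ x ∧ F
  ¬x∧x≈x∧F {x} = begin
    ¬ x ∧ x      ≈⟨ ∧-congˡ ¬-involutive ⟨
    ¬ x ∧ ¬ ¬ x  ≈⟨ ¬x∧F≈x∧¬x ⟨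
    ¬ ¬ x ∧ F    ≈⟨ ∧-congʳ ¬-involutive ⟩
    x ∧ F        ∎

  ¬[¬[x∧¬x]∧y]≈¬[¬x∧y]∧¬[x∧y] : EqMSCL⊢ ¬ (¬ (x ∧ ¬ x) ∧ y) ≈ ¬ (¬ x ∧ y) ∧ ¬ (x ∧ y)
  ¬[¬[x∧¬x]∧y]≈¬[¬x∧y]∧¬[x∧y] {x} {y} = begin
    ¬ (¬ (x ∧ ¬ x) ∧ y)            ≈⟨ cong¬ (∧-congʳ (cong¬ ¬x∧F≈x∧¬x)) ⟨
    ¬ (¬ (¬ x ∧ F) ∧ y)            ≈⟨ cong¬ ¬[¬[¬x∧y]∧¬[x∧y]]≈¬[¬x∧F]∧y ⟨
    ¬ ¬ (¬ (¬ x ∧ y) ∧ ¬ (x ∧ y))  ≈⟨ ¬-involutive ⟩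
    ¬ (¬ x ∧ y) ∧ ¬ (x ∧ y)        ∎

  [x∧¬x]∧¬[x∧¬x]≈x∧¬x : EqMSCL⊢ (x ∧ ¬ x) ∧ ¬ (x ∧ ¬ x) ≈ x ∧ ¬ x
  [x∧¬x]∧¬[x∧¬x]≈x∧¬x {x} = begin
    (x ∧ ¬ x) ∧ ¬ (x ∧ ¬ x)                  ≈⟨ ¬x∧F≈x∧¬x ⟨
    ¬ (x ∧ ¬ x) ∧ F                          ≈⟨ ∧-congʳ (cong¬ ¬x∧F≈x∧¬x) ⟨
    ¬ (¬ x ∧ F) ∧ F                          ≈⟨ ¬[¬[¬x∧y]∧¬[x∧y]]≈¬[¬x∧F]∧y ⟨
    ¬ (¬ (¬ x ∧ F) ∧ ¬ (x ∧ F))              ≈⟨ cong¬ (∧-congʳ ¬[¬x∧F]≈¬[x∧¬x]) ⟩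
    ¬ (¬ (x ∧ ¬ x) ∧ ¬ (x ∧ F))              ≈⟨ ¬[¬[x∧¬x]∧y]≈¬[¬x∧y]∧¬[x∧y] ⟩
    ¬ (¬ x ∧ ¬ (x ∧ F)) ∧ ¬ (x ∧ ¬ (x ∧ F))  ≈⟨ ∧-congʳ (cong¬ ¬x∧¬[x∧y]≈¬x) ⟩
    ¬ ¬ x ∧ ¬ (x ∧ ¬ (x ∧ F))                ≈⟨ ∧-congʳ ¬-involutive ⟩
    x ∧ ¬ (x ∧ ¬ (x ∧ F))                    ≈⟨ ∧-congˡ (cong¬ x∧¬[x∧F]≈x) ⟩
    x ∧ ¬ x                                  ∎

  [x∧F]∧¬[x∧F]≈x∧F : EqMSCL⊢ (x ∧ F) ∧ ¬ (x ∧ F) ≈ x ∧ F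
  [x∧F]∧¬[x∧F]≈x∧F {x} = begin
    (x ∧ F) ∧ ¬ (x ∧ F)              ≈⟨ ∧-congˡ (cong¬ ¬x∧x≈x∧F) ⟨
    (x ∧ F) ∧ ¬ (¬ x ∧ x)            ≈⟨ ∧-congˡ (cong¬ (∧-congˡ ¬-involutive)) ⟨
    (x ∧ F) ∧ ¬ (¬ x ∧ ¬ ¬ x)        ≈⟨ ∧-congʳ ¬x∧x≈x∧F ⟨
    (¬ x ∧ x) ∧ ¬ (¬ x ∧ ¬ ¬ x)      ≈⟨ ∧-congʳ (∧-congˡ ¬-involutive) ⟨
    (¬ x ∧ ¬ ¬ x) ∧ ¬ (¬ x ∧ ¬ ¬ x)  ≈⟨ [x∧¬x]∧¬[x∧¬x]≈x∧¬x ⟩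
    ¬ x ∧ ¬ ¬ x                      ≈⟨ ∧-congˡ ¬-involutive ⟩
    ¬ x ∧ x                          ≈⟨ ¬x∧x≈x∧F ⟩
    x ∧ F                            ∎

  x∧¬x≈x∧F : EqMSCL⊢ x ∧ ¬ x ≈ x ∧ F
  x∧¬x≈x∧F {x} = begin
    x ∧ ¬ x                          ≈⟨ ¬x∧F≈x∧¬x ⟨
    ¬ x ∧ F                          ≈⟨ [x∧F]∧¬[x∧F]≈x∧F ⟨
    (¬ x ∧ F) ∧ ¬ (¬ x ∧ F)          ≈⟨ ¬x∧F≈x∧¬x ⟨
    ¬ (¬ x ∧ F) ∧ F                  ≈⟨ ¬[¬[¬x∧y]∧¬[x∧y]]≈¬[¬x∧F]∧y ⟨
    ¬ (¬ (¬ x ∧ F) ∧ ¬ (x ∧ F))      ≈⟨ cong¬ (∧-congʳ (cong¬ (∧-congˡ ∧-idem))) ⟨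
    ¬ (¬ (¬ x ∧ F ∧ F) ∧ ¬ (x ∧ F))  ≈⟨ ¬[¬[¬x∧y∧z]∧¬[x∧z]]≈¬[¬x∧¬y]∧z ⟩
    ¬ (¬ x ∧ ¬ F) ∧ F                ≈⟨ ∧-congʳ ∨-def ⟨
    (x ∨ F) ∧ F                      ≈⟨ ∧-congʳ x∨F≈x ⟩
    x ∧ F                            ∎

  [x∧F]∧F≈x∧F : EqMSCL⊢ (x ∧ F) ∧ F ≈ x ∧ F
  [x∧F]∧F≈x∧F {x} = begin
    (x ∧ F) ∧ F          ≈⟨ x∧¬x≈x∧F ⟨
    (x ∧ F) ∧ ¬ (x ∧ F)  ≈⟨ [x∧F]∧¬[x∧F]≈x∧F ⟩
    x ∧ F                ∎

  ¬[¬[x∧F]∧y]≈¬[¬x∧y]∧¬[x∧y] : EqMSCL⊢ ¬ (¬ (x ∧ F) ∧ y) ≈ ¬ (¬ x ∧ y) ∧ ¬ (x ∧ y)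
  ¬[¬[x∧F]∧y]≈¬[¬x∧y]∧¬[x∧y] {x} {y} = begin
    ¬ (¬ (x ∧ F) ∧ y)        ≈⟨ cong¬ (∧-congʳ (cong¬ x∧¬x≈x∧F)) ⟨
    ¬ (¬ (x ∧ ¬ x) ∧ y)      ≈⟨ ¬[¬[x∧¬x]∧y]≈¬[¬x∧y]∧¬[x∧y] ⟩
    ¬ (¬ x ∧ y) ∧ ¬ (x ∧ y)  ∎

  ¬[x∧¬[x∧y]]∧x≈x∧y : EqMSCL⊢ ¬ (x ∧ ¬ (x ∧ y)) ∧ x ≈ x ∧ y
  ¬[x∧¬[x∧y]]∧x≈x∧y {x} {y} = begin
    ¬ (x ∧ ¬ (x ∧ y)) ∧ x                        ≈⟨ ∧-congˡ ¬-involutive ⟨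
    ¬ (x ∧ ¬ (x ∧ y)) ∧ ¬ ¬ x                    ≈⟨ ∧-congˡ (cong¬ ¬x∧¬[x∧y]≈¬x) ⟨
    ¬ (x ∧ ¬ (x ∧ y)) ∧ ¬ (¬ x ∧ ¬ (x ∧ y))      ≈⟨ ∧-congʳ (cong¬ (∧-congʳ ¬-involutive)) ⟨
    ¬ (¬ ¬ x ∧ ¬ (x ∧ y)) ∧ ¬ (¬ x ∧ ¬ (x ∧ y))  ≈⟨ ¬[¬[x∧F]∧y]≈¬[¬x∧y]∧¬[x∧y] ⟨
    ¬ (¬ (¬ x ∧ F) ∧ ¬ (x ∧ y))                  ≈⟨ cong¬ (∧-congʳ (cong¬ (∧-congˡ ∧-zeroˡ))) ⟨
    ¬ (¬ (¬ x ∧ F ∧ y) ∧ ¬ (x ∧ y))              ≈⟨ ¬[¬[¬x∧y∧z]∧¬[x∧z]]≈¬[¬x∧¬y]∧z ⟩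
    ¬ (¬ x ∧ ¬ F) ∧ y                            ≈⟨ ∧-congʳ (cong¬ (∧-congˡ ¬F≈T)) ⟩
    ¬ (¬ x ∧ T) ∧ y                              ≈⟨ ∧-congʳ ¬[¬x∧T]≈x ⟩
    x ∧ y                                        ∎

  ¬[¬x∧¬y]∧y≈¬[x∧F]∧y : EqMSCL⊢ ¬ (¬ x ∧ ¬ y) ∧ y ≈ ¬ (x ∧ F) ∧ y
  ¬[¬x∧¬y]∧y≈¬[x∧F]∧y {x} {y} = begin
    ¬ (¬ x ∧ ¬ y) ∧ y                ≈⟨ ¬[¬[¬x∧y∧z]∧¬[x∧z]]≈¬[¬x∧¬y]∧z ⟨
    ¬ (¬ (¬ x ∧ y ∧ y) ∧ ¬ (x ∧ y))  ≈⟨ cong¬ (∧-congʳ (cong¬ (∧-congˡ ∧-idem))) ⟩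
    ¬ (¬ (¬ x ∧ y) ∧ ¬ (x ∧ y))      ≈⟨ cong¬ ¬[¬[x∧F]∧y]≈¬[¬x∧y]∧¬[x∧y] ⟨
    ¬ ¬ (¬ (x ∧ F) ∧ y)              ≈⟨ ¬-involutive ⟩
    ¬ (x ∧ F) ∧ y                    ∎

  ¬[x∧y]∧¬y≈¬[x∧F]∧¬y : EqMSCL⊢ ¬ (x ∧ y) ∧ ¬ y ≈ ¬ (x ∧ F) ∧ ¬ y
  ¬[x∧y]∧¬y≈¬[x∧F]∧¬y {x} {y} = begin
    ¬ (x ∧ y) ∧ ¬ y          ≈⟨ ∧-congʳ (cong¬ (∧-congˡ ¬-involutive)) ⟨
    ¬ (x ∧ ¬ ¬ y) ∧ ¬ y      ≈⟨ ∧-congʳ (cong¬ (∧-congʳ ¬-involutive)) ⟨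
    ¬ (¬ ¬ x ∧ ¬ ¬ y) ∧ ¬ y  ≈⟨ ¬[¬x∧¬y]∧y≈¬[x∧F]∧y ⟩
    ¬ (¬ x ∧ F) ∧ ¬ y        ≈⟨ ∧-congʳ (cong¬ ¬x∧F≈x∧¬x) ⟩
    ¬ (x ∧ ¬ x) ∧ ¬ y        ≈⟨ ∧-congʳ (cong¬ x∧¬x≈x∧F) ⟩
    ¬ (x ∧ F) ∧ ¬ y          ∎

  ¬[¬x∧y]∧¬y≈¬[x∧F]∧¬y : EqMSCL⊢ ¬ (¬ x ∧ y) ∧ ¬ y ≈ ¬ (x ∧ F) ∧ ¬ y
  ¬[¬x∧y]∧¬y≈¬[x∧F]∧¬y {x} {y} = begin
    ¬ (¬ x ∧ y) ∧ ¬ y      ≈⟨ ∧-congʳ (cong¬ (∧-congˡ ¬-involutive)) ⟨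
    ¬ (¬ x ∧ ¬ ¬ y) ∧ ¬ y  ≈⟨ ¬[¬x∧¬y]∧y≈¬[x∧F]∧y ⟩
    ¬ (x ∧ F) ∧ ¬ y        ∎

  x∧¬[x∧¬[x∧y]]≈x∧y : EqMSCL⊢ x ∧ ¬ (x ∧ ¬ (x ∧ y)) ≈ x ∧ y
  x∧¬[x∧¬[x∧y]]≈x∧y {x} {y} = begin
    x ∧ ¬ (x ∧ ¬ (x ∧ y))                    ≈⟨ ∧-congʳ ¬-involutive ⟨
    ¬ ¬ x ∧ ¬ (x ∧ ¬ (x ∧ y))                ≈⟨ ∧-congʳ (cong¬ ¬x∧¬[x∧y]≈¬x) ⟨
    ¬ (¬ x ∧ ¬ (x ∧ y)) ∧ ¬ (x ∧ ¬ (x ∧ y))  ≈⟨ ¬[¬[x∧F]∧y]≈¬[¬x∧y]∧¬[x∧y] ⟨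
    ¬ (¬ (x ∧ F) ∧ ¬ (x ∧ y))                ≈⟨ cong¬ ¬[¬x∧y]∧¬y≈¬[x∧F]∧¬y ⟨
    ¬ (¬ (¬ x ∧ x ∧ y) ∧ ¬ (x ∧ y))          ≈⟨ ¬[¬[¬x∧y∧z]∧¬[x∧z]]≈¬[¬x∧¬y]∧z ⟩
    ¬ (¬ x ∧ ¬ x) ∧ y                        ≈⟨ ∧-congʳ (cong¬ ∧-idem) ⟩
    ¬ ¬ x ∧ y                                ≈⟨ ∧-congʳ ¬-involutive ⟩
    x ∧ y                                    ∎

  ¬[x∧y]∧x≈x∧¬[x∧y] : EqMSCL⊢ ¬ (x ∧ y) ∧ x ≈ x ∧ ¬ (x ∧ y)
  ¬[x∧y]∧x≈x∧¬[x∧y] {x} {y} = begin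
    ¬ (x ∧ y) ∧ x                  ≈⟨ ∧-congʳ (cong¬ x∧¬[x∧¬[x∧y]]≈x∧y) ⟨
    ¬ (x ∧ ¬ (x ∧ ¬ (x ∧ y))) ∧ x  ≈⟨ ¬[x∧¬[x∧y]]∧x≈x∧y ⟩
    x ∧ ¬ (x ∧ y)                  ∎

  ¬[¬x∧¬[¬x∧y]]≈¬[¬x∧¬y] : EqMSCL⊢ ¬ (¬ x ∧ ¬ (¬ x ∧ y)) ≈ ¬ (¬ x ∧ ¬ y)
  ¬[¬x∧¬[¬x∧y]]≈¬[¬x∧¬y] {x} {y} = begin
    ¬ (¬ x ∧ ¬ (¬ x ∧ y))            ≈⟨ cong¬ (∧-congˡ (cong¬ (∧-congˡ ∧-identityʳ))) ⟨
    ¬ (¬ x ∧ ¬ (¬ x ∧ y ∧ T))        ≈⟨ cong¬ ¬[x∧y]∧x≈x∧¬[x∧y] ⟨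
    ¬ (¬ (¬ x ∧ y ∧ T) ∧ ¬ x)        ≈⟨ cong¬ (∧-congˡ (cong¬ ∧-identityʳ)) ⟨
    ¬ (¬ (¬ x ∧ y ∧ T) ∧ ¬ (x ∧ T))  ≈⟨ ¬[¬[¬x∧y∧z]∧¬[x∧z]]≈¬[¬x∧¬y]∧z ⟩
    ¬ (¬ x ∧ ¬ y) ∧ T                ≈⟨ ∧-identityʳ ⟩
    ¬ (¬ x ∧ ¬ y)                    ∎

  ¬x∧¬[¬x∧¬y]≈¬x∧y : EqMSCL⊢ ¬ x ∧ ¬ (¬ x ∧ ¬ y) ≈ ¬ x ∧ y
  ¬x∧¬[¬x∧¬y]≈¬x∧y {x} {y} = begin
    ¬ x ∧ ¬ (¬ x ∧ ¬ y)          ≈⟨ ∧-congˡ ¬[¬x∧¬[¬x∧y]]≈¬[¬x∧¬y] ⟨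
    ¬ x ∧ ¬ (¬ x ∧ ¬ (¬ x ∧ y))  ≈⟨ x∧¬[x∧¬[x∧y]]≈x∧y ⟩
    ¬ x ∧ y                      ∎

  x∧x∧y≈x∧y : EqMSCL⊢ x ∧ x ∧ y ≈ x ∧ y
  x∧x∧y≈x∧y {x} {y} = begin
    x ∧ x ∧ y                          ≈⟨ ∧-congˡ (∧-congʳ ¬-involutive) ⟨
    x ∧ ¬ ¬ x ∧ y                      ≈⟨ ∧-congʳ ¬-involutive ⟨
    ¬ ¬ x ∧ ¬ ¬ x ∧ y                  ≈⟨ ¬x∧¬[¬x∧¬y]≈¬x∧y ⟨
    ¬ ¬ x ∧ ¬ (¬ ¬ x ∧ ¬ (¬ ¬ x ∧ y))  ≈⟨ x∧¬[x∧¬[x∧y]]≈x∧y ⟩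
    ¬ ¬ x ∧ y                          ≈⟨ ∧-congʳ ¬-involutive ⟩
    x ∧ y                              ∎

  [x∧F]∧y≈x∧F : EqMSCL⊢ (x ∧ F) ∧ y ≈ x ∧ F
  [x∧F]∧y≈x∧F {x} {y} = begin
    (x ∧ F) ∧ y
      ≈⟨ x∧x∧y≈x∧y ⟨
    (x ∧ F) ∧ (x ∧ F) ∧ y
      ≈⟨ ∧-congʳ [x∧F]∧F≈x∧F ⟨
    ((x ∧ F) ∧ F) ∧ (x ∧ F) ∧ y
      ≈⟨ ∧-congˡ (∧-congʳ ¬-involutive) ⟨
    ((x ∧ F) ∧ F) ∧ ¬ ¬ (x ∧ F) ∧ y
      ≈⟨ ∧-congˡ (∧-congʳ (cong¬ ∧-idem)) ⟨
    ((x ∧ F) ∧ F) ∧ ¬ (¬ (x ∧ F) ∧ ¬ (x ∧ F)) ∧ y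
      ≈⟨ ∧-congʳ x∧¬x≈x∧F ⟨
    ((x ∧ F) ∧ ¬ (x ∧ F)) ∧ ¬ (¬ (x ∧ F) ∧ ¬ (x ∧ F)) ∧ y
      ≈⟨ ∧-congʳ ¬x∧F≈x∧¬x ⟨
    (¬ (x ∧ F) ∧ F) ∧ ¬ (¬ (x ∧ F) ∧ ¬ (x ∧ F)) ∧ y
      ≈⟨ ∧-congˡ ¬[¬[¬x∧y∧z]∧¬[x∧z]]≈¬[¬x∧¬y]∧z ⟨
    (¬ (x ∧ F) ∧ F) ∧ ¬ (¬ (¬ (x ∧ F) ∧ (x ∧ F) ∧ y) ∧ ¬ ((x ∧ F) ∧ y))
      ≈⟨ ∧-congˡ (cong¬ ¬[x∧y]∧¬y≈¬[x∧F]∧¬y) ⟩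
    (¬ (x ∧ F) ∧ F) ∧ ¬ (¬ (¬ (x ∧ F) ∧ F) ∧ ¬ ((x ∧ F) ∧ y))
      ≈⟨ x∧¬[¬x∧y]≈x ⟩
    ¬ (x ∧ F) ∧ F
      ≈⟨ ¬x∧F≈x∧¬x ⟩
    (x ∧ F) ∧ ¬ (x ∧ F)
      ≈⟨ [x∧F]∧¬[x∧F]≈x∧F ⟩
    x ∧ F ∎

  x∧¬[x∧¬y]≈x∧y : EqMSCL⊢ x ∧ ¬ (x ∧ ¬ y) ≈ x ∧ y
  x∧¬[x∧¬y]≈x∧y {x} {y} = begin
    x ∧ ¬ (x ∧ ¬ y)          ≈⟨ ∧-congˡ (cong¬ (∧-congʳ ¬-involutive)) ⟨
    x ∧ ¬ (¬ ¬ x ∧ ¬ y)      ≈⟨ ∧-congʳ ¬-involutive ⟨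
    ¬ ¬ x ∧ ¬ (¬ ¬ x ∧ ¬ y)  ≈⟨ ¬x∧¬[¬x∧¬y]≈¬x∧y ⟩
    ¬ ¬ x ∧ y                ≈⟨ ∧-congʳ ¬-involutive ⟩
    x ∧ y                    ∎

  x∧¬[x∧y]≈x∧¬y : EqMSCL⊢ x ∧ ¬ (x ∧ y) ≈ x ∧ ¬ y
  x∧¬[x∧y]≈x∧¬y {x} {y} = begin
    x ∧ ¬ (x ∧ y)      ≈⟨ ∧-congˡ (cong¬ (∧-congˡ ¬-involutive)) ⟨
    x ∧ ¬ (x ∧ ¬ ¬ y)  ≈⟨ x∧¬[x∧¬y]≈x∧y ⟩
    x ∧ ¬ y            ∎

  ¬[x∧F]∧¬[x∧y]≈¬[x∧y] : EqMSCL⊢ ¬ (x ∧ F) ∧ ¬ (x ∧ y) ≈ ¬ (x ∧ y)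
  ¬[x∧F]∧¬[x∧y]≈¬[x∧y] {x} {y} = begin
    ¬ (x ∧ F) ∧ ¬ (x ∧ y)      ≈⟨ ¬[x∧y]∧¬y≈¬[x∧F]∧¬y ⟨
    ¬ (x ∧ x ∧ y) ∧ ¬ (x ∧ y)  ≈⟨ ∧-congʳ (cong¬ x∧x∧y≈x∧y) ⟩
    ¬ (x ∧ y) ∧ ¬ (x ∧ y)      ≈⟨ ∧-idem ⟩
    ¬ (x ∧ y)                  ∎

  ¬[x∧F]∧¬[¬x∧y]≈¬[¬x∧y] : EqMSCL⊢ ¬ (x ∧ F) ∧ ¬ (¬ x ∧ y) ≈ ¬ (¬ x ∧ y)
  ¬[x∧F]∧¬[¬x∧y]≈¬[¬x∧y] {x} {y} = begin
    ¬ (x ∧ F) ∧ ¬ (¬ x ∧ y)    ≈⟨ ∧-congʳ (cong¬ x∧¬x≈x∧F) ⟨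
    ¬ (x ∧ ¬ x) ∧ ¬ (¬ x ∧ y)  ≈⟨ ∧-congʳ (cong¬ ¬x∧F≈x∧¬x) ⟨
    ¬ (¬ x ∧ F) ∧ ¬ (¬ x ∧ y)  ≈⟨ ¬[x∧F]∧¬[x∧y]≈¬[x∧y] ⟩
    ¬ (¬ x ∧ y)                ∎

  ¬[x∧¬[y∧¬x]]≈¬[x∧¬y]∧¬x : EqMSCL⊢ ¬ (x ∧ ¬ (y ∧ ¬ x)) ≈ ¬ (x ∧ ¬ y) ∧ ¬ x
  ¬[x∧¬[y∧¬x]]≈¬[x∧¬y]∧¬x {x} {y} = begin
    ¬ (x ∧ ¬ (y ∧ ¬ x))                      ≈⟨ cong¬ (∧-congʳ ¬-involutive) ⟨
    ¬ (¬ ¬ x ∧ ¬ (y ∧ ¬ x))                  ≈⟨ ¬[¬x∧¬[¬x∧y]]≈¬[¬x∧¬y] ⟨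
    ¬ (¬ ¬ x ∧ ¬ (¬ ¬ x ∧ y ∧ ¬ x))          ≈⟨ cong¬ ¬[x∧y]∧x≈x∧¬[x∧y] ⟨
    ¬ (¬ (¬ ¬ x ∧ y ∧ ¬ x) ∧ ¬ ¬ x)          ≈⟨ cong¬ (∧-congˡ (cong¬ ∧-idem)) ⟨
    ¬ (¬ (¬ ¬ x ∧ y ∧ ¬ x) ∧ ¬ (¬ x ∧ ¬ x))  ≈⟨ ¬[¬[¬x∧y∧z]∧¬[x∧z]]≈¬[¬x∧¬y]∧z ⟩
    ¬ (¬ ¬ x ∧ ¬ y) ∧ ¬ x                    ≈⟨ ∧-congʳ (cong¬ (∧-congʳ ¬-involutive)) ⟩
    ¬ (x ∧ ¬ y) ∧ ¬ x                        ∎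

  ¬[¬[x∧¬y]∧¬x]≈x∧¬[y∧¬x] : EqMSCL⊢ ¬ (¬ (x ∧ ¬ y) ∧ ¬ x) ≈ x ∧ ¬ (y ∧ ¬ x)
  ¬[¬[x∧¬y]∧¬x]≈x∧¬[y∧¬x] {x} {y} = begin
    ¬ (¬ (x ∧ ¬ y) ∧ ¬ x)  ≈⟨ cong¬ ¬[x∧¬[y∧¬x]]≈¬[x∧¬y]∧¬x ⟨
    ¬ ¬ (x ∧ ¬ (y ∧ ¬ x))  ≈⟨ ¬-involutive ⟩
    x ∧ ¬ (y ∧ ¬ x)        ∎

  x∧¬[x∧¬y]∧¬x≈x∧y∧¬x : EqMSCL⊢ x ∧ ¬ (x ∧ ¬ y) ∧ ¬ x ≈ x ∧ y ∧ ¬ x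
  x∧¬[x∧¬y]∧¬x≈x∧y∧¬x {x} {y} = begin
    x ∧ ¬ (x ∧ ¬ y) ∧ ¬ x    ≈⟨ ∧-congˡ ¬[x∧¬[y∧¬x]]≈¬[x∧¬y]∧¬x ⟨
    x ∧ ¬ (x ∧ ¬ (y ∧ ¬ x))  ≈⟨ x∧¬[x∧¬y]≈x∧y ⟩
    x ∧ y ∧ ¬ x              ∎

  ¬[¬[x∧y]∧¬[¬x∧y]]≈¬[x∧F]∧y : EqMSCL⊢ ¬ (¬ (x ∧ y) ∧ ¬ (¬ x ∧ y)) ≈ ¬ (x ∧ F) ∧ y
  ¬[¬[x∧y]∧¬[¬x∧y]]≈¬[x∧F]∧y {x} {y} = begin
    ¬ (¬ (x ∧ y) ∧ ¬ (¬ x ∧ y))      ≈⟨ cong¬ (∧-congʳ (cong¬ (∧-congʳ ¬-involutive))) ⟨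
    ¬ (¬ (¬ ¬ x ∧ y) ∧ ¬ (¬ x ∧ y))  ≈⟨ ¬[¬[¬x∧y]∧¬[x∧y]]≈¬[¬x∧F]∧y ⟩
    ¬ (¬ ¬ x ∧ F) ∧ y                ≈⟨ ∧-congʳ (cong¬ (∧-congʳ ¬-involutive)) ⟩
    ¬ (x ∧ F) ∧ y                    ∎

  ¬[¬x∧y]∧¬[x∧y]≈¬[x∧y]∧¬[¬x∧y] : EqMSCL⊢ ¬ (¬ x ∧ y) ∧ ¬ (x ∧ y) ≈ ¬ (x ∧ y) ∧ ¬ (¬ x ∧ y)
  ¬[¬x∧y]∧¬[x∧y]≈¬[x∧y]∧¬[¬x∧y] {x} {y} = begin
    ¬ (¬ x ∧ y) ∧ ¬ (x ∧ y)        ≈⟨ ¬[¬[x∧F]∧y]≈¬[¬x∧y]∧¬[x∧y] ⟨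
    ¬ (¬ (x ∧ F) ∧ y)              ≈⟨ cong¬ ¬[¬[x∧y]∧¬[¬x∧y]]≈¬[x∧F]∧y ⟨
    ¬ ¬ (¬ (x ∧ y) ∧ ¬ (¬ x ∧ y))  ≈⟨ ¬-involutive ⟩
    ¬ (x ∧ y) ∧ ¬ (¬ x ∧ y)        ∎

  ¬[[x∧y]∧F]∧¬x≈¬[x∧¬y]∧¬x : EqMSCL⊢ ¬ ((x ∧ y) ∧ F) ∧ ¬ x ≈ ¬ (x ∧ ¬ y) ∧ ¬ x
  ¬[[x∧y]∧F]∧¬x≈¬[x∧¬y]∧¬x {x} {y} = begin
    ¬ ((x ∧ y) ∧ F) ∧ ¬ x              ≈⟨ ¬[¬x∧y]∧¬y≈¬[x∧F]∧¬y ⟨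
    ¬ (¬ (x ∧ y) ∧ x) ∧ ¬ x            ≈⟨ ∧-congʳ (cong¬ (∧-congʳ (cong¬ x∧¬[x∧¬y]≈x∧y))) ⟨
    ¬ (¬ (x ∧ ¬ (x ∧ ¬ y)) ∧ x) ∧ ¬ x  ≈⟨ ∧-congʳ (cong¬ ¬[x∧¬[x∧y]]∧x≈x∧y) ⟩
    ¬ (x ∧ ¬ y) ∧ ¬ x                  ∎

  ¬[x∧y]∧¬[¬x∧y]≈¬[x∧F]∧¬y : EqMSCL⊢ ¬ (x ∧ y) ∧ ¬ (¬ x ∧ y) ≈ ¬ (x ∧ F) ∧ ¬ y
  ¬[x∧y]∧¬[¬x∧y]≈¬[x∧F]∧¬y {x} {y} = begin
    ¬ (x ∧ y) ∧ ¬ (¬ x ∧ y)              ≈⟨ ¬[¬x∧y]∧¬[x∧y]≈¬[x∧y]∧¬[¬x∧y] ⟨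
    ¬ (¬ x ∧ y) ∧ ¬ (x ∧ y)              ≈⟨ ¬[¬[x∧F]∧y]≈¬[¬x∧y]∧¬[x∧y] ⟨
    ¬ (¬ (x ∧ F) ∧ y)                    ≈⟨ ¬[x∧F]∧¬[¬x∧y]≈¬[¬x∧y] ⟨
    ¬ ((x ∧ F) ∧ F) ∧ ¬ (¬ (x ∧ F) ∧ y)  ≈⟨ ∧-congʳ (cong¬ [x∧F]∧y≈x∧F) ⟩
    ¬ (x ∧ F) ∧ ¬ (¬ (x ∧ F) ∧ y)        ≈⟨ x∧¬[x∧y]≈x∧¬y ⟩
    ¬ (x ∧ F) ∧ ¬ y                      ∎

  ¬[[x∧y]∧F]∧x≈x∧¬[y∧¬x] : EqMSCL⊢ ¬ ((x ∧ y) ∧ F) ∧ x ≈ x ∧ ¬ (y ∧ ¬ x)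
  ¬[[x∧y]∧F]∧x≈x∧¬[y∧¬x] {x} {y} = begin
    ¬ ((x ∧ y) ∧ F) ∧ x                      ≈⟨ ¬[¬[x∧y]∧¬[¬x∧y]]≈¬[x∧F]∧y ⟨
    ¬ (¬ ((x ∧ y) ∧ x) ∧ ¬ (¬ (x ∧ y) ∧ x))  ≈⟨ cong¬ ¬[x∧y]∧¬[¬x∧y]≈¬[x∧F]∧¬y ⟩
    ¬ (¬ ((x ∧ y) ∧ F) ∧ ¬ x)                ≈⟨ cong¬ ¬[[x∧y]∧F]∧¬x≈¬[x∧¬y]∧¬x ⟩
    ¬ (¬ (x ∧ ¬ y) ∧ ¬ x)                    ≈⟨ ¬[¬[x∧¬y]∧¬x]≈x∧¬[y∧¬x] ⟩
    x ∧ ¬ (y ∧ ¬ x)                          ∎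

  [¬[x∧F]∧y]∧y≈¬[x∧F]∧y : EqMSCL⊢ (¬ (x ∧ F) ∧ y) ∧ y ≈ ¬ (x ∧ F) ∧ y
  [¬[x∧F]∧y]∧y≈¬[x∧F]∧y {x} {y} = begin
    (¬ (x ∧ F) ∧ y) ∧ y              ≈⟨ ∧-congʳ ¬[¬[x∧y]∧¬[¬x∧y]]≈¬[x∧F]∧y ⟨
    ¬ (¬ (x ∧ y) ∧ ¬ (¬ x ∧ y)) ∧ y  ≈⟨ ∧-congʳ (cong¬ ¬[x∧y]∧¬[¬x∧y]≈¬[x∧F]∧¬y) ⟩
    ¬ (¬ (x ∧ F) ∧ ¬ y) ∧ y          ≈⟨ ¬[¬x∧¬y]∧y≈¬[x∧F]∧y ⟩
    ¬ ((x ∧ F) ∧ F) ∧ y              ≈⟨ ∧-congʳ (cong¬ [x∧F]∧F≈x∧F) ⟩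
    ¬ (x ∧ F) ∧ y                    ∎

  ¬[[x∧y]∧F]∧¬x≈¬[x∧y]∧¬x : EqMSCL⊢ ¬ ((x ∧ y) ∧ F) ∧ ¬ x ≈ ¬ (x ∧ y) ∧ ¬ x
  ¬[[x∧y]∧F]∧¬x≈¬[x∧y]∧¬x {x} {y} = begin
    ¬ ((x ∧ y) ∧ F) ∧ ¬ x                ≈⟨ ¬[x∧y]∧¬[¬x∧y]≈¬[x∧F]∧¬y ⟨
    ¬ ((x ∧ y) ∧ x) ∧ ¬ (¬ (x ∧ y) ∧ x)  ≈⟨ ¬[¬x∧y]∧¬[x∧y]≈¬[x∧y]∧¬[¬x∧y] ⟨
    ¬ (¬ (x ∧ y) ∧ x) ∧ ¬ ((x ∧ y) ∧ x)  ≈⟨ ¬[¬[x∧F]∧y]≈¬[¬x∧y]∧¬[x∧y] ⟨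
    ¬ (¬ ((x ∧ y) ∧ F) ∧ x)              ≈⟨ cong¬ [¬[x∧F]∧y]∧y≈¬[x∧F]∧y ⟨
    ¬ ((¬ ((x ∧ y) ∧ F) ∧ x) ∧ x)        ≈⟨ cong¬ (∧-congʳ ¬[[x∧y]∧F]∧x≈x∧¬[y∧¬x]) ⟩
    ¬ ((x ∧ ¬ (y ∧ ¬ x)) ∧ x)            ≈⟨ cong¬ (∧-congʳ ¬[¬[x∧¬y]∧¬x]≈x∧¬[y∧¬x]) ⟨
    ¬ (¬ (¬ (x ∧ ¬ y) ∧ ¬ x) ∧ x)        ≈⟨ cong¬ ¬[¬x∧¬y]∧y≈¬[x∧F]∧y ⟩
    ¬ (¬ ((x ∧ ¬ y) ∧ F) ∧ x)            ≈⟨ cong¬ ¬[[x∧y]∧F]∧x≈x∧¬[y∧¬x] ⟩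
    ¬ (x ∧ ¬ (¬ y ∧ ¬ x))                ≈⟨ ¬[x∧¬[y∧¬x]]≈¬[x∧¬y]∧¬x ⟩
    ¬ (x ∧ ¬ ¬ y) ∧ ¬ x                  ≈⟨ ∧-congʳ (cong¬ (∧-congˡ ¬-involutive)) ⟩
    ¬ (x ∧ y) ∧ ¬ x                      ∎

  [x∧y]∧¬x≈[x∧y]∧F : EqMSCL⊢ (x ∧ y) ∧ ¬ x ≈ (x ∧ y) ∧ F
  [x∧y]∧¬x≈[x∧y]∧F {x} {y} = begin
    (x ∧ y) ∧ ¬ x
      ≈⟨ ∧-congˡ ¬x∧¬[x∧y]≈¬x ⟨
    (x ∧ y) ∧ ¬ x ∧ ¬ (x ∧ y)
      ≈⟨ x∧¬[x∧¬y]∧¬x≈x∧y∧¬x ⟨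
    (x ∧ y) ∧ ¬ ((x ∧ y) ∧ ¬ ¬ x) ∧ ¬ (x ∧ y)
      ≈⟨ ∧-congˡ ¬[[x∧y]∧F]∧¬x≈¬[x∧¬y]∧¬x ⟨
    (x ∧ y) ∧ ¬ (((x ∧ y) ∧ ¬ x) ∧ F) ∧ ¬ (x ∧ y)
      ≈⟨ ∧-congˡ ¬[[x∧y]∧F]∧¬x≈¬[x∧y]∧¬x ⟩
    (x ∧ y) ∧ ¬ ((x ∧ y) ∧ ¬ x) ∧ ¬ (x ∧ y)
      ≈⟨ ∧-congˡ ¬[x∧¬[y∧¬x]]≈¬[x∧¬y]∧¬x ⟨
    (x ∧ y) ∧ ¬ ((x ∧ y) ∧ ¬ (x ∧ ¬ (x ∧ y)))
      ≈⟨ ∧-congˡ (cong¬ (∧-congˡ (cong¬ ¬[x∧y]∧x≈x∧¬[x∧y]))) ⟨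
    (x ∧ y) ∧ ¬ ((x ∧ y) ∧ ¬ (¬ (x ∧ y) ∧ x))
      ≈⟨ ∧-congˡ (cong¬ x∧¬[¬x∧y]≈x) ⟩
    (x ∧ y) ∧ ¬ (x ∧ y)
      ≈⟨ x∧¬x≈x∧F ⟩
    (x ∧ y) ∧ F ∎

  ¬[x∧y]∧¬[x∧F]≈¬[x∧y] : EqMSCL⊢ ¬ (x ∧ y) ∧ ¬ (x ∧ F) ≈ ¬ (x ∧ y)
  ¬[x∧y]∧¬[x∧F]≈¬[x∧y] {x} {y} = begin
    ¬ (x ∧ y) ∧ ¬ (x ∧ F)
      ≈⟨ ∧-congʳ ¬[x∧F]∧¬[x∧y]≈¬[x∧y] ⟨
    (¬ (x ∧ F) ∧ ¬ (x ∧ y)) ∧ ¬ (x ∧ F)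
      ≈⟨ x∧¬[x∧¬y]≈x∧y ⟨
    (¬ (x ∧ F) ∧ ¬ (x ∧ y)) ∧ ¬ ((¬ (x ∧ F) ∧ ¬ (x ∧ y)) ∧ ¬ ¬ (x ∧ F))
      ≈⟨ ∧-congˡ (cong¬ [x∧y]∧¬x≈[x∧y]∧F) ⟩
    (¬ (x ∧ F) ∧ ¬ (x ∧ y)) ∧ ¬ ((¬ (x ∧ F) ∧ ¬ (x ∧ y)) ∧ F)
      ≈⟨ x∧¬[x∧F]≈x ⟩
    ¬ (x ∧ F) ∧ ¬ (x ∧ y)
      ≈⟨ ¬[x∧F]∧¬[x∧y]≈¬[x∧y] ⟩
    ¬ (x ∧ y) ∎

  ¬[¬x∧y]∧¬[x∧F]≈¬[¬x∧y] : EqMSCL⊢ ¬ (¬ x ∧ y) ∧ ¬ (x ∧ F) ≈ ¬ (¬ x ∧ y)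
  ¬[¬x∧y]∧¬[x∧F]≈¬[¬x∧y] {x} {y} = begin
    ¬ (¬ x ∧ y) ∧ ¬ (x ∧ F)    ≈⟨ ∧-congˡ (cong¬ x∧¬x≈x∧F) ⟨
    ¬ (¬ x ∧ y) ∧ ¬ (x ∧ ¬ x)  ≈⟨ ∧-congˡ (cong¬ ¬x∧F≈x∧¬x) ⟨
    ¬ (¬ x ∧ y) ∧ ¬ (¬ x ∧ F)  ≈⟨ ¬[x∧y]∧¬[x∧F]≈¬[x∧y] ⟩
    ¬ (¬ x ∧ y)                ∎

  [x∧y]∧F≈x∧y∧F : EqMSCL⊢ (x ∧ y) ∧ F ≈ x ∧ y ∧ F
  [x∧y]∧F≈x∧y∧F {x} {y} = begin
    (x ∧ y) ∧ F                            ≈⟨ ∧-congʳ (∧-congˡ ¬-involutive) ⟨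
    (x ∧ ¬ ¬ y) ∧ F                        ≈⟨ ∧-congʳ (∧-congʳ ¬-involutive) ⟨
    (¬ ¬ x ∧ ¬ ¬ y) ∧ F                    ≈⟨ x∧¬x≈x∧F ⟨
    (¬ ¬ x ∧ ¬ ¬ y) ∧ ¬ (¬ ¬ x ∧ ¬ ¬ y)    ≈⟨ ¬x∧F≈x∧¬x ⟨
    ¬ (¬ ¬ x ∧ ¬ ¬ y) ∧ F                  ≈⟨ ¬[¬[¬x∧y∧z]∧¬[x∧z]]≈¬[¬x∧¬y]∧z ⟨
    ¬ (¬ (¬ ¬ x ∧ ¬ y ∧ F) ∧ ¬ (¬ x ∧ F))  ≈⟨ cong¬ ¬[¬x∧y]∧¬[x∧F]≈¬[¬x∧y] ⟩
    ¬ ¬ (¬ ¬ x ∧ ¬ y ∧ F)                  ≈⟨ ¬-involutive ⟩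
    ¬ ¬ x ∧ ¬ y ∧ F                        ≈⟨ ∧-congʳ ¬-involutive ⟩
    x ∧ ¬ y ∧ F                            ≈⟨ ∧-congˡ ¬x∧F≈x∧¬x ⟩
    x ∧ y ∧ ¬ y                            ≈⟨ ∧-congˡ x∧¬x≈x∧F ⟩
    x ∧ y ∧ F                              ∎

  ¬[¬[x∧y∧z]∧¬[¬x∧z]]≈¬[x∧¬y]∧z : EqMSCL⊢ ¬ (¬ (x ∧ y ∧ z) ∧ ¬ (¬ x ∧ z)) ≈ ¬ (x ∧ ¬ y) ∧ z
  ¬[¬[x∧y∧z]∧¬[¬x∧z]]≈¬[x∧¬y]∧z {x} {y} {z} = begin
    ¬ (¬ (x ∧ y ∧ z) ∧ ¬ (¬ x ∧ z))      ≈⟨ cong¬ (∧-congʳ (cong¬ (∧-congʳ ¬-involutive))) ⟨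
    ¬ (¬ (¬ ¬ x ∧ y ∧ z) ∧ ¬ (¬ x ∧ z))  ≈⟨ ¬[¬[¬x∧y∧z]∧¬[x∧z]]≈¬[¬x∧¬y]∧z ⟩
    ¬ (¬ ¬ x ∧ ¬ y) ∧ z                  ≈⟨ ∧-congʳ (cong¬ (∧-congʳ ¬-involutive)) ⟩
    ¬ (x ∧ ¬ y) ∧ z                      ∎

  x∧y∧x≈x∧y : EqMSCL⊢ x ∧ y ∧ x ≈ x ∧ y
  x∧y∧x≈x∧y {x} {y} = begin
    x ∧ y ∧ x                        ≈⟨ ¬-involutive ⟨
    ¬ ¬ (x ∧ y ∧ x)                  ≈⟨ cong¬ ¬[x∧y]∧¬[x∧F]≈¬[x∧y] ⟨
    ¬ (¬ (x ∧ y ∧ x) ∧ ¬ (x ∧ F))    ≈⟨ cong¬ (∧-congˡ (cong¬ ¬x∧x≈x∧F)) ⟨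
    ¬ (¬ (x ∧ y ∧ x) ∧ ¬ (¬ x ∧ x))  ≈⟨ ¬[¬[x∧y∧z]∧¬[¬x∧z]]≈¬[x∧¬y]∧z ⟩
    ¬ (x ∧ ¬ y) ∧ x                  ≈⟨ ¬[x∧y]∧x≈x∧¬[x∧y] ⟩
    x ∧ ¬ (x ∧ ¬ y)                  ≈⟨ x∧¬[x∧¬y]≈x∧y ⟩
    x ∧ y                            ∎

  ¬[x∧y]∧x≈x∧¬y : EqMSCL⊢ ¬ (x ∧ y) ∧ x ≈ x ∧ ¬ y
  ¬[x∧y]∧x≈x∧¬y {x} {y} = begin
    ¬ (x ∧ y) ∧ x  ≈⟨ ¬[x∧y]∧x≈x∧¬[x∧y] ⟩
    x ∧ ¬ (x ∧ y)  ≈⟨ x∧¬[x∧y]≈x∧¬y ⟩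
    x ∧ ¬ y        ∎

  x∧¬[y∧x]≈x∧¬y : EqMSCL⊢ x ∧ ¬ (y ∧ x) ≈ x ∧ ¬ y
  x∧¬[y∧x]≈x∧¬y {x} {y} = begin
    x ∧ ¬ (y ∧ x)      ≈⟨ ¬[x∧y]∧x≈x∧¬y ⟨
    ¬ (x ∧ y ∧ x) ∧ x  ≈⟨ ∧-congʳ (cong¬ x∧y∧x≈x∧y) ⟩
    ¬ (x ∧ y) ∧ x      ≈⟨ ¬[x∧y]∧x≈x∧¬y ⟩
    x ∧ ¬ y            ∎

  ¬[¬[x∧F]∧¬[x∧y]]≈x∧y : EqMSCL⊢ ¬ (¬ (x ∧ F) ∧ ¬ (x ∧ y)) ≈ x ∧ y
  ¬[¬[x∧F]∧¬[x∧y]]≈x∧y {x} {y} = begin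
    ¬ (¬ (x ∧ F) ∧ ¬ (x ∧ y))  ≈⟨ cong¬ ¬[x∧F]∧¬[x∧y]≈¬[x∧y] ⟩
    ¬ ¬ (x ∧ y)                ≈⟨ ¬-involutive ⟩
    x ∧ y                      ∎

  ¬[¬[x∧y]∧¬x]≈x∧¬[y∧F] : EqMSCL⊢ ¬ (¬ (x ∧ y) ∧ ¬ x) ≈ x ∧ ¬ (y ∧ F)
  ¬[¬[x∧y]∧¬x]≈x∧¬[y∧F] {x} {y} = begin
    ¬ (¬ (x ∧ y) ∧ ¬ x)            ≈⟨ cong¬ ¬[[x∧y]∧F]∧¬x≈¬[x∧y]∧¬x ⟨
    ¬ (¬ ((x ∧ y) ∧ F) ∧ ¬ x)      ≈⟨ cong¬ (∧-congʳ (cong¬ [x∧y]∧F≈x∧y∧F)) ⟩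
    ¬ (¬ (x ∧ y ∧ F) ∧ ¬ x)        ≈⟨ cong¬ ¬[[x∧y]∧F]∧¬x≈¬[x∧y]∧¬x ⟨
    ¬ (¬ ((x ∧ y ∧ F) ∧ F) ∧ ¬ x)  ≈⟨ cong¬ ¬[[x∧y]∧F]∧¬x≈¬[x∧¬y]∧¬x ⟩
    ¬ (¬ (x ∧ ¬ (y ∧ F)) ∧ ¬ x)    ≈⟨ ¬[¬[x∧¬y]∧¬x]≈x∧¬[y∧¬x] ⟩
    x ∧ ¬ ((y ∧ F) ∧ ¬ x)          ≈⟨ ∧-congˡ (cong¬ [x∧F]∧y≈x∧F) ⟩
    x ∧ ¬ (y ∧ F)                  ∎

  [x∧¬y]∧y∧x∧F≈[x∧¬y]∧y : EqMSCL⊢ (x ∧ ¬ y) ∧ y ∧ x ∧ F ≈ (x ∧ ¬ y) ∧ y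
  [x∧¬y]∧y∧x∧F≈[x∧¬y]∧y {x} {y} = begin
    (x ∧ ¬ y) ∧ y ∧ x ∧ F                    ≈⟨ ∧-congˡ x∧x∧y≈x∧y ⟨
    (x ∧ ¬ y) ∧ y ∧ y ∧ x ∧ F                ≈⟨ ∧-congˡ (∧-congˡ [x∧y]∧F≈x∧y∧F) ⟨
    (x ∧ ¬ y) ∧ y ∧ (y ∧ x) ∧ F              ≈⟨ ∧-congˡ (∧-congˡ [x∧y]∧¬x≈[x∧y]∧F) ⟨
    (x ∧ ¬ y) ∧ y ∧ (y ∧ x) ∧ ¬ y            ≈⟨ ∧-congˡ x∧¬[x∧¬y]∧¬x≈x∧y∧¬x ⟨
    (x ∧ ¬ y) ∧ y ∧ ¬ (y ∧ ¬ (y ∧ x)) ∧ ¬ y  ≈⟨ ∧-congˡ (∧-congˡ (∧-congʳ (cong¬ x∧¬[x∧y]≈x∧¬y))) ⟩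
    (x ∧ ¬ y) ∧ y ∧ ¬ (y ∧ ¬ x) ∧ ¬ y        ≈⟨ ∧-congˡ x∧¬[x∧¬y]∧¬x≈x∧y∧¬x ⟩
    (x ∧ ¬ y) ∧ y ∧ x ∧ ¬ y                  ≈⟨ x∧y∧x≈x∧y ⟩
    (x ∧ ¬ y) ∧ y                            ∎

  [x∧y]∧¬y≈[x∧y]∧y∧F : EqMSCL⊢ (x ∧ y) ∧ ¬ y ≈ (x ∧ y) ∧ y ∧ F
  [x∧y]∧¬y≈[x∧y]∧y∧F {x} {y} = begin
    (x ∧ y) ∧ ¬ y                    ≈⟨ ∧-congʳ (∧-congˡ ¬-involutive) ⟨
    (x ∧ ¬ ¬ y) ∧ ¬ y                ≈⟨ [x∧¬y]∧y∧x∧F≈[x∧¬y]∧y ⟨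
    (x ∧ ¬ ¬ y) ∧ ¬ y ∧ x ∧ F        ≈⟨ ∧-congˡ (∧-congˡ [x∧F]∧F≈x∧F) ⟨
    (x ∧ ¬ ¬ y) ∧ ¬ y ∧ (x ∧ F) ∧ F  ≈⟨ ∧-congˡ [x∧y]∧F≈x∧y∧F ⟨
    (x ∧ ¬ ¬ y) ∧ (¬ y ∧ x ∧ F) ∧ F  ≈⟨ [x∧y]∧F≈x∧y∧F ⟨
    ((x ∧ ¬ ¬ y) ∧ ¬ y ∧ x ∧ F) ∧ F  ≈⟨ ∧-congʳ [x∧¬y]∧y∧x∧F≈[x∧¬y]∧y ⟩
    ((x ∧ ¬ ¬ y) ∧ ¬ y) ∧ F          ≈⟨ [x∧y]∧F≈x∧y∧F ⟩
    (x ∧ ¬ ¬ y) ∧ ¬ y ∧ F            ≈⟨ ∧-congʳ (∧-congˡ ¬-involutive) ⟩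
    (x ∧ y) ∧ ¬ y ∧ F                ≈⟨ ∧-congˡ ¬x∧F≈x∧¬x ⟩
    (x ∧ y) ∧ y ∧ ¬ y                ≈⟨ ∧-congˡ x∧¬x≈x∧F ⟩
    (x ∧ y) ∧ y ∧ F                  ∎

  ¬[¬x∧¬y]∧y∧z≈¬[x∧F]∧y∧z : EqMSCL⊢ ¬ (¬ x ∧ ¬ y) ∧ y ∧ z ≈ ¬ (x ∧ F) ∧ y ∧ z
  ¬[¬x∧¬y]∧y∧z≈¬[x∧F]∧y∧z {x} {y} {z} = begin
    ¬ (¬ x ∧ ¬ y) ∧ y ∧ z                    ≈⟨ ¬[¬[¬x∧y∧z]∧¬[x∧z]]≈¬[¬x∧¬y]∧z ⟨
    ¬ (¬ (¬ x ∧ y ∧ y ∧ z) ∧ ¬ (x ∧ y ∧ z))  ≈⟨ cong¬ (∧-congʳ (cong¬ (∧-congˡ x∧x∧y≈x∧y))) ⟩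
    ¬ (¬ (¬ x ∧ y ∧ z) ∧ ¬ (x ∧ y ∧ z))      ≈⟨ cong¬ ¬[¬[x∧F]∧y]≈¬[¬x∧y]∧¬[x∧y] ⟨
    ¬ ¬ (¬ (x ∧ F) ∧ y ∧ z)                  ≈⟨ ¬-involutive ⟩
    ¬ (x ∧ F) ∧ y ∧ z                        ∎

  x∧[x∧y]∧z≈[x∧y]∧z : EqMSCL⊢ x ∧ (x ∧ y) ∧ z ≈ (x ∧ y) ∧ z
  x∧[x∧y]∧z≈[x∧y]∧z {x} {y} {z} = begin
    x ∧ (x ∧ y) ∧ z                          ≈⟨ ∧-congʳ ¬-involutive ⟨
    ¬ ¬ x ∧ (x ∧ y) ∧ z                      ≈⟨ ∧-congʳ (cong¬ ¬x∧¬[x∧y]≈¬x) ⟨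
    ¬ (¬ x ∧ ¬ (x ∧ y)) ∧ (x ∧ y) ∧ z        ≈⟨ ¬[¬x∧¬y]∧y∧z≈¬[x∧F]∧y∧z ⟩
    ¬ (x ∧ F) ∧ (x ∧ y) ∧ z                  ≈⟨ ∧-congʳ (cong¬ [x∧F]∧F≈x∧F) ⟨
    ¬ ((x ∧ F) ∧ F) ∧ (x ∧ y) ∧ z            ≈⟨ ¬[¬x∧¬y]∧y∧z≈¬[x∧F]∧y∧z ⟨
    ¬ (¬ (x ∧ F) ∧ ¬ (x ∧ y)) ∧ (x ∧ y) ∧ z  ≈⟨ ∧-congʳ ¬[¬[x∧F]∧¬[x∧y]]≈x∧y ⟩
    (x ∧ y) ∧ (x ∧ y) ∧ z                    ≈⟨ x∧x∧y≈x∧y ⟩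
    (x ∧ y) ∧ z                              ∎

  [x∧¬[y∧F]]∧y≈[x∧y]∧y : EqMSCL⊢ (x ∧ ¬ (y ∧ F)) ∧ y ≈ (x ∧ y) ∧ y
  [x∧¬[y∧F]]∧y≈[x∧y]∧y {x} {y} = begin
    (x ∧ ¬ (y ∧ F)) ∧ y                          ≈⟨ ∧-congʳ ¬[¬[x∧y]∧¬x]≈x∧¬[y∧F] ⟨
    ¬ (¬ (x ∧ y) ∧ ¬ x) ∧ y                      ≈⟨ ¬[¬[¬x∧y∧z]∧¬[x∧z]]≈¬[¬x∧¬y]∧z ⟨
    ¬ (¬ (¬ (x ∧ y) ∧ x ∧ y) ∧ ¬ ((x ∧ y) ∧ y))  ≈⟨ cong¬ (∧-congʳ (cong¬ ¬x∧x≈x∧F)) ⟩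
    ¬ (¬ ((x ∧ y) ∧ F) ∧ ¬ ((x ∧ y) ∧ y))        ≈⟨ ¬[¬[x∧F]∧¬[x∧y]]≈x∧y ⟩
    (x ∧ y) ∧ y                                  ∎

  [x∧y]∧y∧F≈x∧y∧F : EqMSCL⊢ (x ∧ y) ∧ y ∧ F ≈ x ∧ y ∧ F
  [x∧y]∧y∧F≈x∧y∧F {x} {y} = begin
    (x ∧ y) ∧ y ∧ F                ≈⟨ [x∧y]∧F≈x∧y∧F ⟨
    ((x ∧ y) ∧ y) ∧ F              ≈⟨ ∧-congʳ [x∧¬[y∧F]]∧y≈[x∧y]∧y ⟨
    ((x ∧ ¬ (y ∧ F)) ∧ y) ∧ F      ≈⟨ [x∧y]∧F≈x∧y∧F ⟩
    (x ∧ ¬ (y ∧ F)) ∧ y ∧ F        ≈⟨ ∧-congʳ (∧-congˡ (cong¬ [x∧F]∧y≈x∧F)) ⟨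
    (x ∧ ¬ ((y ∧ F) ∧ F)) ∧ y ∧ F  ≈⟨ [x∧¬[y∧F]]∧y≈[x∧y]∧y ⟩
    (x ∧ y ∧ F) ∧ y ∧ F            ≈⟨ ∧-congʳ [x∧y]∧F≈x∧y∧F ⟨
    ((x ∧ y) ∧ F) ∧ y ∧ F          ≈⟨ [x∧F]∧y≈x∧F ⟩
    (x ∧ y) ∧ F                    ≈⟨ [x∧y]∧F≈x∧y∧F ⟩
    x ∧ y ∧ F                      ∎

  ¬[x∧¬y]∧x∧z≈x∧y∧x∧z : EqMSCL⊢ ¬ (x ∧ ¬ y) ∧ x ∧ z ≈ x ∧ y ∧ x ∧ z
  ¬[x∧¬y]∧x∧z≈x∧y∧x∧z {x} {y} {z} = begin
    ¬ (x ∧ ¬ y) ∧ x ∧ z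
      ≈⟨ ¬[¬[x∧y∧z]∧¬[¬x∧z]]≈¬[x∧¬y]∧z ⟨
    ¬ (¬ (x ∧ y ∧ x ∧ z) ∧ ¬ (¬ x ∧ x ∧ z))
      ≈⟨ cong¬ (∧-congˡ (cong¬ ¬x∧¬[¬x∧¬y]≈¬x∧y)) ⟨
    ¬ (¬ (x ∧ y ∧ x ∧ z) ∧ ¬ (¬ x ∧ ¬ (¬ x ∧ ¬ (x ∧ z))))
      ≈⟨ cong¬ (∧-congˡ (cong¬ (∧-congˡ (cong¬ ¬x∧¬[x∧y]≈¬x)))) ⟩
    ¬ (¬ (x ∧ y ∧ x ∧ z) ∧ ¬ (¬ x ∧ ¬ ¬ x))
      ≈⟨ cong¬ (∧-congˡ (cong¬ ¬x∧F≈x∧¬x)) ⟨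
    ¬ (¬ (x ∧ y ∧ x ∧ z) ∧ ¬ (¬ ¬ x ∧ F))
      ≈⟨ cong¬ (∧-congˡ (cong¬ (∧-congʳ ¬-involutive))) ⟩
    ¬ (¬ (x ∧ y ∧ x ∧ z) ∧ ¬ (x ∧ F))
      ≈⟨ cong¬ ¬[x∧y]∧¬[x∧F]≈¬[x∧y] ⟩
    ¬ ¬ (x ∧ y ∧ x ∧ z)
      ≈⟨ ¬-involutive ⟩
    x ∧ y ∧ x ∧ z ∎

  x∧¬[¬x∧y]∧x∧z≈x∧z : EqMSCL⊢ x ∧ ¬ (¬ x ∧ y) ∧ x ∧ z ≈ x ∧ z
  x∧¬[¬x∧y]∧x∧z≈x∧z {x} {y} {z} = begin
    x ∧ ¬ (¬ x ∧ y) ∧ x ∧ z              ≈⟨ ¬[x∧¬y]∧x∧z≈x∧y∧x∧z ⟨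
    ¬ (x ∧ ¬ ¬ (¬ x ∧ y)) ∧ x ∧ z        ≈⟨ ∧-congʳ (cong¬ x∧¬[x∧y]≈x∧¬y) ⟨
    ¬ (x ∧ ¬ (x ∧ ¬ (¬ x ∧ y))) ∧ x ∧ z  ≈⟨ ¬[x∧¬y]∧x∧z≈x∧y∧x∧z ⟩
    x ∧ (x ∧ ¬ (¬ x ∧ y)) ∧ x ∧ z        ≈⟨ x∧[x∧y]∧z≈[x∧y]∧z ⟩
    (x ∧ ¬ (¬ x ∧ y)) ∧ x ∧ z            ≈⟨ ∧-congʳ x∧¬[¬x∧y]≈x ⟩
    x ∧ x ∧ z                            ≈⟨ x∧x∧y≈x∧y ⟩
    x ∧ z                                ∎

  ¬[x∧¬[y∧z]]∧z≈¬[x∧¬y]∧z : EqMSCL⊢ ¬ (x ∧ ¬ (y ∧ z)) ∧ z ≈ ¬ (x ∧ ¬ y) ∧ z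
  ¬[x∧¬[y∧z]]∧z≈¬[x∧¬y]∧z {x} {y} {z} = begin
    ¬ (x ∧ ¬ (y ∧ z)) ∧ z
      ≈⟨ ¬[¬[x∧y∧z]∧¬[¬x∧z]]≈¬[x∧¬y]∧z ⟨
    ¬ (¬ (x ∧ (y ∧ z) ∧ z) ∧ ¬ (¬ x ∧ z))
      ≈⟨ cong¬ (∧-congʳ (cong¬ (∧-congˡ (∧-congˡ ¬-involutive)))) ⟨
    ¬ (¬ (x ∧ (y ∧ z) ∧ ¬ ¬ z) ∧ ¬ (¬ x ∧ z))
      ≈⟨ cong¬ (∧-congʳ (cong¬ (∧-congˡ ¬[x∧y]∧x≈x∧¬y))) ⟨
    ¬ (¬ (x ∧ ¬ ((y ∧ z) ∧ ¬ z) ∧ y ∧ z) ∧ ¬ (¬ x ∧ z))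
      ≈⟨ cong¬ (∧-congʳ (cong¬ (∧-congˡ (∧-congʳ (cong¬ [x∧y]∧¬y≈[x∧y]∧y∧F))))) ⟩
    ¬ (¬ (x ∧ ¬ ((y ∧ z) ∧ z ∧ F) ∧ y ∧ z) ∧ ¬ (¬ x ∧ z))
      ≈⟨ cong¬ (∧-congʳ (cong¬ (∧-congˡ (∧-congʳ (cong¬ [x∧y]∧y∧F≈x∧y∧F))))) ⟩
    ¬ (¬ (x ∧ ¬ (y ∧ z ∧ F) ∧ y ∧ z) ∧ ¬ (¬ x ∧ z))
      ≈⟨ cong¬ (∧-congʳ (cong¬ (∧-congˡ (∧-congʳ (cong¬ [x∧y]∧F≈x∧y∧F))))) ⟨
    ¬ (¬ (x ∧ ¬ ((y ∧ z) ∧ F) ∧ y ∧ z) ∧ ¬ (¬ x ∧ z))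
      ≈⟨ cong¬ (∧-congʳ (cong¬ (∧-congˡ ¬[x∧y]∧x≈x∧¬[x∧y]))) ⟩
    ¬ (¬ (x ∧ (y ∧ z) ∧ ¬ ((y ∧ z) ∧ F)) ∧ ¬ (¬ x ∧ z))
      ≈⟨ cong¬ (∧-congʳ (cong¬ (∧-congˡ x∧¬[x∧F]≈x))) ⟩
    ¬ (¬ (x ∧ y ∧ z) ∧ ¬ (¬ x ∧ z))
      ≈⟨ ¬[¬[x∧y∧z]∧¬[¬x∧z]]≈¬[x∧¬y]∧z ⟩
    ¬ (x ∧ ¬ y) ∧ z ∎

  x∧¬[y∧¬[¬x∧z]]≈x∧¬y : EqMSCL⊢ x ∧ ¬ (y ∧ ¬ (¬ x ∧ z)) ≈ x ∧ ¬ y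
  x∧¬[y∧¬[¬x∧z]]≈x∧¬y {x} {y} {z} = begin
    x ∧ ¬ (y ∧ ¬ (¬ x ∧ z))
      ≈⟨ x∧¬[¬x∧y]∧x∧z≈x∧z ⟨
    x ∧ ¬ (¬ x ∧ z) ∧ x ∧ ¬ (y ∧ ¬ (¬ x ∧ z))
      ≈⟨ ∧-congˡ (∧-congˡ ¬-involutive) ⟨
    x ∧ ¬ (¬ x ∧ z) ∧ ¬ ¬ (x ∧ ¬ (y ∧ ¬ (¬ x ∧ z)))
      ≈⟨ ∧-congˡ x∧¬[y∧x]≈x∧¬y ⟨
    x ∧ ¬ (¬ x ∧ z) ∧ ¬ (¬ (x ∧ ¬ (y ∧ ¬ (¬ x ∧ z))) ∧ ¬ (¬ x ∧ z))
      ≈⟨ ∧-congˡ (∧-congˡ (cong¬ ¬[x∧¬[y∧z]]∧z≈¬[x∧¬y]∧z)) ⟩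
    x ∧ ¬ (¬ x ∧ z) ∧ ¬ (¬ (x ∧ ¬ y) ∧ ¬ (¬ x ∧ z))
      ≈⟨ ∧-congˡ x∧¬[y∧x]≈x∧¬y ⟩
    x ∧ ¬ (¬ x ∧ z) ∧ ¬ ¬ (x ∧ ¬ y)
      ≈⟨ ∧-congˡ (∧-congˡ ¬-involutive) ⟩
    x ∧ ¬ (¬ x ∧ z) ∧ x ∧ ¬ y
      ≈⟨ x∧¬[¬x∧y]∧x∧z≈x∧z ⟩
    x ∧ ¬ y ∎

  x∧¬[x∧¬y]∧z≈x∧y∧z : EqMSCL⊢ x ∧ ¬ (x ∧ ¬ y) ∧ z ≈ x ∧ y ∧ z
  x∧¬[x∧¬y]∧z≈x∧y∧z {x} {y} {z} = begin
    x ∧ ¬ (x ∧ ¬ y) ∧ z                      ≈⟨ ∧-congˡ (∧-congʳ (cong¬ (∧-congʳ ¬-involutive))) ⟨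
    x ∧ ¬ (¬ ¬ x ∧ ¬ y) ∧ z                  ≈⟨ ∧-congˡ ¬[¬[¬x∧y∧z]∧¬[x∧z]]≈¬[¬x∧¬y]∧z ⟨
    x ∧ ¬ (¬ (¬ ¬ x ∧ y ∧ z) ∧ ¬ (¬ x ∧ z))  ≈⟨ x∧¬[y∧¬[¬x∧z]]≈x∧¬y ⟩
    x ∧ ¬ ¬ (¬ ¬ x ∧ y ∧ z)                  ≈⟨ ∧-congˡ ¬-involutive ⟩
    x ∧ ¬ ¬ x ∧ y ∧ z                        ≈⟨ ∧-congˡ (∧-congʳ ¬-involutive) ⟩
    x ∧ x ∧ y ∧ z                            ≈⟨ x∧x∧y≈x∧y ⟩
    x ∧ y ∧ z                                ∎

  ∧-assoc : EqMSCL⊢ (x ∧ y) ∧ z ≈ x ∧ y ∧ z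
  ∧-assoc {x} {y} {z} = begin
    (x ∧ y) ∧ z                ≈⟨ x∧[x∧y]∧z≈[x∧y]∧z ⟨
    x ∧ (x ∧ y) ∧ z            ≈⟨ x∧¬[x∧¬y]∧z≈x∧y∧z ⟨
    x ∧ ¬ (x ∧ ¬ (x ∧ y)) ∧ z  ≈⟨ ∧-congˡ (∧-congʳ (cong¬ x∧¬[x∧y]≈x∧¬y)) ⟩
    x ∧ ¬ (x ∧ ¬ y) ∧ z        ≈⟨ x∧¬[x∧¬y]∧z≈x∧y∧z ⟩
    x ∧ y ∧ z                  ∎

  x∧y∧x∧z≈x∧y∧z : EqMSCL⊢ x ∧ y ∧ x ∧ z ≈ x ∧ y ∧ z
  x∧y∧x∧z≈x∧y∧z {x} {y} {z} = begin
    x ∧ y ∧ x ∧ z              ≈⟨ ∧-congˡ ∧-assoc ⟨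
    x ∧ (y ∧ x) ∧ z            ≈⟨ x∧¬[x∧¬y]∧z≈x∧y∧z ⟨
    x ∧ ¬ (x ∧ ¬ (y ∧ x)) ∧ z  ≈⟨ ∧-congˡ (∧-congʳ (cong¬ x∧¬[y∧x]≈x∧¬y)) ⟩
    x ∧ ¬ (x ∧ ¬ y) ∧ z        ≈⟨ x∧¬[x∧¬y]∧z≈x∧y∧z ⟩
    x ∧ y ∧ z                  ∎

  x∧¬[y∧x∧z]≈x∧¬[y∧z] : EqMSCL⊢ x ∧ ¬ (y ∧ x ∧ z) ≈ x ∧ ¬ (y ∧ z)
  x∧¬[y∧x∧z]≈x∧¬[y∧z] {x} {y} {z} = begin
    x ∧ ¬ (y ∧ x ∧ z)      ≈⟨ ¬[x∧y]∧x≈x∧¬y ⟨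
    ¬ (x ∧ y ∧ x ∧ z) ∧ x  ≈⟨ ∧-congʳ (cong¬ x∧y∧x∧z≈x∧y∧z) ⟩
    ¬ (x ∧ y ∧ z) ∧ x      ≈⟨ ¬[x∧y]∧x≈x∧¬y ⟩
    x ∧ ¬ (y ∧ z)          ∎

  x∧y∧¬[x∧z]≈x∧y∧¬z : EqMSCL⊢ x ∧ y ∧ ¬ (x ∧ z) ≈ x ∧ y ∧ ¬ z
  x∧y∧¬[x∧z]≈x∧y∧¬z {x} {y} {z} = begin
    x ∧ y ∧ ¬ (x ∧ z)      ≈⟨ x∧y∧x∧z≈x∧y∧z ⟨
    x ∧ y ∧ x ∧ ¬ (x ∧ z)  ≈⟨ ∧-congˡ (∧-congˡ x∧¬[x∧y]≈x∧¬y) ⟩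
    x ∧ y ∧ x ∧ ¬ z        ≈⟨ x∧y∧x∧z≈x∧y∧z ⟩
    x ∧ y ∧ ¬ z            ∎

  ¬[x∧¬[y∧z]]≈¬[x∧¬y]∧¬[x∧¬z] : EqMSCL⊢ ¬ (x ∧ ¬ (y ∧ z)) ≈ ¬ (x ∧ ¬ y) ∧ ¬ (x ∧ ¬ z)
  ¬[x∧¬[y∧z]]≈¬[x∧¬y]∧¬[x∧¬z] {x} {y} {z} = begin
    ¬ (x ∧ ¬ (y ∧ z))
      ≈⟨ cong¬ x∧¬[y∧x∧z]≈x∧¬[y∧z] ⟨
    ¬ (x ∧ ¬ (y ∧ x ∧ z))
      ≈⟨ cong¬ (∧-congˡ (cong¬ (∧-congˡ x∧¬[x∧¬y]≈x∧y))) ⟨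
    ¬ (x ∧ ¬ (y ∧ x ∧ ¬ (x ∧ ¬ z)))
      ≈⟨ cong¬ x∧¬[y∧x∧z]≈x∧¬[y∧z] ⟩
    ¬ (x ∧ ¬ (y ∧ ¬ (x ∧ ¬ z)))
      ≈⟨ cong¬ ¬[x∧y]∧x≈x∧¬y ⟨
    ¬ (¬ (x ∧ y ∧ ¬ (x ∧ ¬ z)) ∧ x)
      ≈⟨ cong¬ (∧-congˡ ¬-involutive) ⟨
    ¬ (¬ (x ∧ y ∧ ¬ (x ∧ ¬ z)) ∧ ¬ ¬ x)
      ≈⟨ cong¬ (∧-congˡ (cong¬ ¬x∧¬[x∧y]≈¬x)) ⟨
    ¬ (¬ (x ∧ y ∧ ¬ (x ∧ ¬ z)) ∧ ¬ (¬ x ∧ ¬ (x ∧ ¬ z)))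
      ≈⟨ ¬[¬[x∧y∧z]∧¬[¬x∧z]]≈¬[x∧¬y]∧z ⟩
    ¬ (x ∧ ¬ y) ∧ ¬ (x ∧ ¬ z) ∎

  x∧[[x∧y]∨[¬x∧z]]≈x∧y : EqMSCL⊢ x ∧ ((x ∧ y) ∨ (¬ x ∧ z)) ≈ x ∧ y
  x∧[[x∧y]∨[¬x∧z]]≈x∧y {x} {y} {z} = begin
    x ∧ ((x ∧ y) ∨ (¬ x ∧ z))        ≈⟨ ∧-congˡ ∨-def ⟩
    x ∧ ¬ (¬ (x ∧ y) ∧ ¬ (¬ x ∧ z))  ≈⟨ x∧¬[y∧¬[¬x∧z]]≈x∧¬y ⟩
    x ∧ ¬ ¬ (x ∧ y)                  ≈⟨ ∧-congˡ ¬-involutive ⟩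
    x ∧ x ∧ y                        ≈⟨ x∧x∧y≈x∧y ⟩
    x ∧ y                            ∎

  ∧-distribˡ-∨ : EqMSCL⊢ x ∧ (y ∨ z) ≈ (x ∧ y) ∨ (x ∧ z)
  ∧-distribˡ-∨ {x} {y} {z} = begin
    x ∧ (y ∨ z)
      ≈⟨ ∧-congˡ ∨-def ⟩
    x ∧ ¬ (¬ y ∧ ¬ z)
      ≈⟨ ∧-congˡ ¬[x∧F]∧¬[¬x∧y]≈¬[¬x∧y] ⟨
    x ∧ ¬ (y ∧ F) ∧ ¬ (¬ y ∧ ¬ z)
      ≈⟨ x∧y∧¬[x∧z]≈x∧y∧¬z ⟨
    x ∧ ¬ (y ∧ F) ∧ ¬ (x ∧ ¬ y ∧ ¬ z)
      ≈⟨ ∧-congˡ (∧-congˡ (cong¬ x∧¬[x∧¬y]∧z≈x∧y∧z)) ⟨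
    x ∧ ¬ (y ∧ F) ∧ ¬ (x ∧ ¬ (x ∧ ¬ ¬ y) ∧ ¬ z)
      ≈⟨ ∧-congˡ (∧-congˡ (cong¬ (∧-congˡ (∧-congʳ (cong¬ (∧-congˡ ¬-involutive)))))) ⟩
    x ∧ ¬ (y ∧ F) ∧ ¬ (x ∧ ¬ (x ∧ y) ∧ ¬ z)
      ≈⟨ x∧y∧¬[x∧z]≈x∧y∧¬z ⟩
    x ∧ ¬ (y ∧ F) ∧ ¬ (¬ (x ∧ y) ∧ ¬ z)
      ≈⟨ ∧-assoc ⟨
    (x ∧ ¬ (y ∧ F)) ∧ ¬ (¬ (x ∧ y) ∧ ¬ z)
      ≈⟨ ∧-congʳ ¬[¬[x∧y]∧¬x]≈x∧¬[y∧F] ⟨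
    ¬ (¬ (x ∧ y) ∧ ¬ x) ∧ ¬ (¬ (x ∧ y) ∧ ¬ z)
      ≈⟨ ¬[x∧¬[y∧z]]≈¬[x∧¬y]∧¬[x∧¬z] ⟨
    ¬ (¬ (x ∧ y) ∧ ¬ (x ∧ z))
      ≈⟨ ∨-def ⟨
    (x ∧ y) ∨ (x ∧ z) ∎

  ¬x∧¬[x∧y]∧z≈¬x∧z : EqMSCL⊢ ¬ x ∧ ¬ (x ∧ y) ∧ z ≈ ¬ x ∧ z
  ¬x∧¬[x∧y]∧z≈¬x∧z {x} {y} {z} = begin
    ¬ x ∧ ¬ (x ∧ y) ∧ z    ≈⟨ ∧-assoc ⟨
    (¬ x ∧ ¬ (x ∧ y)) ∧ z  ≈⟨ ∧-congʳ ¬x∧¬[x∧y]≈¬x ⟩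
    ¬ x ∧ z                ∎

  [x∨T]∧¬y≈¬[[x∨T]∧y] : EqMSCL⊢ (x ∨ T) ∧ ¬ y ≈ ¬ ((x ∨ T) ∧ y)
  [x∨T]∧¬y≈¬[[x∨T]∧y] {x} {y} = begin
    (x ∨ T) ∧ ¬ y                            ≈⟨ ∧-congʳ ∨-def ⟩
    ¬ (¬ x ∧ ¬ T) ∧ ¬ y                      ≈⟨ ∧-congʳ (cong¬ (∧-congˡ F≈¬T)) ⟨
    ¬ (¬ x ∧ F) ∧ ¬ y                        ≈⟨ ¬[x∧y]∧x≈x∧¬y ⟨
    ¬ (¬ (¬ x ∧ F) ∧ y) ∧ ¬ (¬ x ∧ F)        ≈⟨ ∧-congˡ (cong¬ [x∧F]∧F≈x∧F) ⟨
    ¬ (¬ (¬ x ∧ F) ∧ y) ∧ ¬ ((¬ x ∧ F) ∧ F)  ≈⟨ ¬[¬x∧y]∧¬[x∧F]≈¬[¬x∧y] ⟩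
    ¬ (¬ (¬ x ∧ F) ∧ y)                      ≈⟨ cong¬ (∧-congʳ (cong¬ (∧-congˡ F≈¬T))) ⟩
    ¬ (¬ (¬ x ∧ ¬ T) ∧ y)                    ≈⟨ cong¬ (∧-congʳ ∨-def) ⟨
    ¬ ((x ∨ T) ∧ y)                          ∎

  ¬x∧[[x∧y]∨[¬x∧z]]≈¬x∧z : EqMSCL⊢ ¬ x ∧ ((x ∧ y) ∨ (¬ x ∧ z)) ≈ ¬ x ∧ z
  ¬x∧[[x∧y]∨[¬x∧z]]≈¬x∧z {x} {y} {z} = begin
    ¬ x ∧ ((x ∧ y) ∨ (¬ x ∧ z))                    ≈⟨ ∧-congˡ ∨-def ⟩
    ¬ x ∧ ¬ (¬ (x ∧ y) ∧ ¬ (¬ x ∧ z))              ≈⟨ ¬x∧¬[x∧y]∧z≈¬x∧z ⟨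
    ¬ x ∧ ¬ (x ∧ y) ∧ ¬ (¬ (x ∧ y) ∧ ¬ (¬ x ∧ z))  ≈⟨ ∧-congˡ x∧¬[x∧¬y]≈x∧y ⟩
    ¬ x ∧ ¬ (x ∧ y) ∧ ¬ x ∧ z                      ≈⟨ ¬x∧¬[x∧y]∧z≈¬x∧z ⟩
    ¬ x ∧ ¬ x ∧ z                                  ≈⟨ x∧x∧y≈x∧y ⟩
    ¬ x ∧ z                                        ∎

  infix 25 _◂_▸_

  -- g (t₁ ◁ t₂ ▷ t₃) is definitionally g t₁ ◂ g t₂ ▸ g t₃.
  _◂_▸_ : SCLTerm A → SCLTerm A → SCLTerm A → SCLTerm A
  x ◂ y ▸ z = (y ∧ x) ∨ (¬ y ∧ z)

  x◂T▸y≈x : EqMSCL⊢ x ◂ T ▸ y ≈ x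
  x◂T▸y≈x {x} {y} = begin
    x ◂ T ▸ y            ≡⟨⟩
    (T ∧ x) ∨ (¬ T ∧ y)  ≈⟨ ∨-congʳ ∧-identityˡ ⟩
    x ∨ (¬ T ∧ y)        ≈⟨ ∨-congˡ (∧-congʳ F≈¬T) ⟨
    x ∨ (F ∧ y)          ≈⟨ ∨-congˡ ∧-zeroˡ ⟩
    x ∨ F                ≈⟨ x∨F≈x ⟩
    x                    ∎

  x◂F▸y≈y : EqMSCL⊢ x ◂ F ▸ y ≈ y
  x◂F▸y≈y {x} {y} = begin
    x ◂ F ▸ y            ≡⟨⟩
    (F ∧ x) ∨ (¬ F ∧ y)  ≈⟨ ∨-congʳ ∧-zeroˡ ⟩
    F ∨ (¬ F ∧ y)        ≈⟨ ∨-congˡ (∧-congʳ ¬F≈T) ⟩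
    F ∨ (T ∧ y)          ≈⟨ ∨-congˡ ∧-identityˡ ⟩
    F ∨ y                ≈⟨ F∨x≈x ⟩
    y                    ∎

  T◂x▸F≈x : EqMSCL⊢ T ◂ x ▸ F ≈ x
  T◂x▸F≈x {x} = begin
    T ◂ x ▸ F              ≡⟨⟩
    (x ∧ T) ∨ (¬ x ∧ F)    ≈⟨ ∨-congʳ ∧-identityʳ ⟩
    x ∨ (¬ x ∧ F)          ≈⟨ ∨-def ⟩
    ¬ (¬ x ∧ ¬ (¬ x ∧ F))  ≈⟨ cong¬ x∧¬[x∧y]≈x∧¬y ⟩
    ¬ (¬ x ∧ ¬ F)          ≈⟨ ∨-def ⟨
    x ∨ F                  ≈⟨ x∨F≈x ⟩
    x                      ∎

  -- Prefixing (¬ y ∨ T) ∧ _ only makes y be evaluated first: this is harmless in front of a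
  -- conditional on y, and splits whatever follows into the cases y and ¬ y.
  [¬y∨T]∧u≈[y∧u]∨[¬y∧u] : EqMSCL⊢ (¬ y ∨ T) ∧ u ≈ (y ∧ u) ∨ (¬ y ∧ u)
  [¬y∨T]∧u≈[y∧u]∨[¬y∧u] {y} {u} = begin
    (¬ y ∨ T) ∧ u                ≈⟨ mem-distribʳ ⟩
    (¬ ¬ y ∧ T ∧ u) ∨ (¬ y ∧ u)  ≈⟨ ∨-congʳ (cong∧ ¬-involutive ∧-identityˡ) ⟩
    (y ∧ u) ∨ (¬ y ∧ u)          ∎

  [¬y∨T]∧[x◂y▸z]≈x◂y▸z : EqMSCL⊢ (¬ y ∨ T) ∧ (x ◂ y ▸ z) ≈ x ◂ y ▸ z
  [¬y∨T]∧[x◂y▸z]≈x◂y▸z {y} {x} {z} = begin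
    (¬ y ∨ T) ∧ (x ◂ y ▸ z)                  ≈⟨ [¬y∨T]∧u≈[y∧u]∨[¬y∧u] ⟩
    (y ∧ (x ◂ y ▸ z)) ∨ (¬ y ∧ (x ◂ y ▸ z))  ≈⟨ cong∨ x∧[[x∧y]∨[¬x∧z]]≈x∧y
                                                     ¬x∧[[x∧y]∨[¬x∧z]]≈¬x∧z ⟩
    x ◂ y ▸ z                                ∎

  ◂▸-distribʳ-∧ : EqMSCL⊢ (x ◂ y ▸ z) ∧ u ≈ (x ∧ u) ◂ y ▸ (z ∧ u)
  ◂▸-distribʳ-∧ {x} {y} {z} {u} = begin
    (x ◂ y ▸ z) ∧ u                  ≈⟨ ∧-congʳ [¬y∨T]∧[x◂y▸z]≈x◂y▸z ⟨
    ((¬ y ∨ T) ∧ (x ◂ y ▸ z)) ∧ u    ≈⟨ ∧-assoc ⟩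
    (¬ y ∨ T) ∧ (x ◂ y ▸ z) ∧ u      ≈⟨ [¬y∨T]∧u≈[y∧u]∨[¬y∧u] ⟩
    (y ∧ (x ◂ y ▸ z) ∧ u) ∨ (¬ y ∧ (x ◂ y ▸ z) ∧ u)
      ≈⟨ cong∨ ∧-assoc ∧-assoc ⟨
    ((y ∧ (x ◂ y ▸ z)) ∧ u) ∨ ((¬ y ∧ (x ◂ y ▸ z)) ∧ u)
      ≈⟨ cong∨ (∧-congʳ x∧[[x∧y]∨[¬x∧z]]≈x∧y) (∧-congʳ ¬x∧[[x∧y]∨[¬x∧z]]≈¬x∧z) ⟩
    ((y ∧ x) ∧ u) ∨ ((¬ y ∧ z) ∧ u)  ≈⟨ cong∨ ∧-assoc ∧-assoc ⟩
    (x ∧ u) ◂ y ▸ (z ∧ u)            ∎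

  ¬-◂▸ : EqMSCL⊢ ¬ (x ◂ y ▸ z) ≈ ¬ x ◂ y ▸ ¬ z
  ¬-◂▸ {x} {y} {z} = begin
    ¬ (x ◂ y ▸ z)                                ≈⟨ cong¬ [¬y∨T]∧[x◂y▸z]≈x◂y▸z ⟨
    ¬ ((¬ y ∨ T) ∧ (x ◂ y ▸ z))                  ≈⟨ [x∨T]∧¬y≈¬[[x∨T]∧y] ⟨
    (¬ y ∨ T) ∧ ¬ (x ◂ y ▸ z)                    ≈⟨ [¬y∨T]∧u≈[y∧u]∨[¬y∧u] ⟩
    (y ∧ ¬ (x ◂ y ▸ z)) ∨ (¬ y ∧ ¬ (x ◂ y ▸ z))  ≈⟨ cong∨ x∧¬[x∧y]≈x∧¬y x∧¬[x∧y]≈x∧¬y ⟨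
    (y ∧ ¬ (y ∧ (x ◂ y ▸ z))) ∨ (¬ y ∧ ¬ (¬ y ∧ (x ◂ y ▸ z)))
      ≈⟨ cong∨ (∧-congˡ (cong¬ x∧[[x∧y]∨[¬x∧z]]≈x∧y))
               (∧-congˡ (cong¬ ¬x∧[[x∧y]∨[¬x∧z]]≈¬x∧z)) ⟩
    (y ∧ ¬ (y ∧ x)) ∨ (¬ y ∧ ¬ (¬ y ∧ z))        ≈⟨ cong∨ x∧¬[x∧y]≈x∧¬y x∧¬[x∧y]≈x∧¬y ⟩
    ¬ x ◂ y ▸ ¬ z                                ∎

  y∧[w∨[u◂y▸v]]≈y∧[w∨u] : EqMSCL⊢ y ∧ (w ∨ (u ◂ y ▸ v)) ≈ y ∧ (w ∨ u)
  y∧[w∨[u◂y▸v]]≈y∧[w∨u] {y} {w} {u} {v} = begin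
    y ∧ (w ∨ (u ◂ y ▸ v))        ≈⟨ ∧-distribˡ-∨ ⟩
    (y ∧ w) ∨ (y ∧ (u ◂ y ▸ v))  ≈⟨ ∨-congˡ x∧[[x∧y]∨[¬x∧z]]≈x∧y ⟩
    (y ∧ w) ∨ (y ∧ u)            ≈⟨ ∧-distribˡ-∨ ⟨
    y ∧ (w ∨ u)                  ∎

  ¬y∧[w∨[u◂y▸v]]≈¬y∧[w∨v] : EqMSCL⊢ ¬ y ∧ (w ∨ (u ◂ y ▸ v)) ≈ ¬ y ∧ (w ∨ v)
  ¬y∧[w∨[u◂y▸v]]≈¬y∧[w∨v] {y} {w} {u} {v} = begin
    ¬ y ∧ (w ∨ (u ◂ y ▸ v))          ≈⟨ ∧-distribˡ-∨ ⟩
    (¬ y ∧ w) ∨ (¬ y ∧ (u ◂ y ▸ v))  ≈⟨ ∨-congˡ ¬x∧[[x∧y]∨[¬x∧z]]≈¬x∧z ⟩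
    (¬ y ∧ w) ∨ (¬ y ∧ v)            ≈⟨ ∧-distribˡ-∨ ⟨
    ¬ y ∧ (w ∨ v)                    ∎

  ◂▸-∨-◂▸ : EqMSCL⊢ (x ◂ y ▸ z) ∨ (u ◂ y ▸ v) ≈ (x ∨ u) ◂ y ▸ (z ∨ v)
  ◂▸-∨-◂▸ {x} {y} {z} {u} {v} = begin
    (x ◂ y ▸ z) ∨ (u ◂ y ▸ v)                              ≈⟨ ∨-def ⟩
    ¬ (¬ (x ◂ y ▸ z) ∧ ¬ (u ◂ y ▸ v))                      ≈⟨ cong¬ (∧-congʳ ¬-◂▸) ⟩
    ¬ ((¬ x ◂ y ▸ ¬ z) ∧ ¬ (u ◂ y ▸ v))                    ≈⟨ cong¬ ◂▸-distribʳ-∧ ⟩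
    ¬ ((¬ x ∧ ¬ (u ◂ y ▸ v)) ◂ y ▸ (¬ z ∧ ¬ (u ◂ y ▸ v)))  ≈⟨ ¬-◂▸ ⟩
    ¬ (¬ x ∧ ¬ (u ◂ y ▸ v)) ◂ y ▸ ¬ (¬ z ∧ ¬ (u ◂ y ▸ v))
      ≈⟨ cong∨ (∧-congˡ ∨-def) (∧-congˡ ∨-def) ⟨
    (x ∨ (u ◂ y ▸ v)) ◂ y ▸ (z ∨ (u ◂ y ▸ v))
      ≈⟨ cong∨ y∧[w∨[u◂y▸v]]≈y∧[w∨u] ¬y∧[w∨[u◂y▸v]]≈¬y∧[w∨v] ⟩
    (x ∨ u) ◂ y ▸ (z ∨ v)                                  ∎

  x◂[y◂z▸u]▸v≈[x◂y▸v]◂z▸[x◂u▸v] :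
    EqMSCL⊢ x ◂ (y ◂ z ▸ u) ▸ v ≈ (x ◂ y ▸ v) ◂ z ▸ (x ◂ u ▸ v)
  x◂[y◂z▸u]▸v≈[x◂y▸v]◂z▸[x◂u▸v] {x} {y} {z} {u} {v} = begin
    x ◂ (y ◂ z ▸ u) ▸ v                                    ≡⟨⟩
    ((y ◂ z ▸ u) ∧ x) ∨ (¬ (y ◂ z ▸ u) ∧ v)                ≈⟨ cong∨ ◂▸-distribʳ-∧ (∧-congʳ ¬-◂▸) ⟩
    ((y ∧ x) ◂ z ▸ (u ∧ x)) ∨ ((¬ y ◂ z ▸ ¬ u) ∧ v)        ≈⟨ ∨-congˡ ◂▸-distribʳ-∧ ⟩
    ((y ∧ x) ◂ z ▸ (u ∧ x)) ∨ ((¬ y ∧ v) ◂ z ▸ (¬ u ∧ v))  ≈⟨ ◂▸-∨-◂▸ ⟩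
    (x ◂ y ▸ v) ◂ z ▸ (x ◂ u ▸ v)                          ∎

  x◂y▸[z◂u▸[v◂y▸w]]≈x◂y▸[z◂u▸w] :
    EqMSCL⊢ x ◂ y ▸ (z ◂ u ▸ (v ◂ y ▸ w)) ≈ x ◂ y ▸ (z ◂ u ▸ w)
  x◂y▸[z◂u▸[v◂y▸w]]≈x◂y▸[z◂u▸w] {x} {y} {z} {u} {v} {w} = ∨-congˡ (begin
    ¬ y ∧ (z ◂ u ▸ (v ◂ y ▸ w))                      ≈⟨ ∧-distribˡ-∨ ⟩
    (¬ y ∧ u ∧ z) ∨ (¬ y ∧ ¬ u ∧ (v ◂ y ▸ w))        ≈⟨ ∨-congˡ x∧y∧x∧z≈x∧y∧z ⟨
    (¬ y ∧ u ∧ z) ∨ (¬ y ∧ ¬ u ∧ ¬ y ∧ (v ◂ y ▸ w))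
      ≈⟨ ∨-congˡ (∧-congˡ (∧-congˡ ¬x∧[[x∧y]∨[¬x∧z]]≈¬x∧z)) ⟩
    (¬ y ∧ u ∧ z) ∨ (¬ y ∧ ¬ u ∧ ¬ y ∧ w)            ≈⟨ ∨-congˡ x∧y∧x∧z≈x∧y∧z ⟩
    (¬ y ∧ u ∧ z) ∨ (¬ y ∧ ¬ u ∧ w)                  ≈⟨ ∧-distribˡ-∨ ⟨
    ¬ y ∧ (z ◂ u ▸ w)                                ∎)

  axiom-sound : {l r : CPTerm A} (σ : Var → CPTerm A) → CPmemAxiom l r →
                EqMSCL⊢ g (substCP σ l) ≈ g (substCP σ r)
  axiom-sound σ CP1   = x◂T▸y≈x
  axiom-sound σ CP2   = x◂F▸y≈y
  axiom-sound σ CP3   = T◂x▸F≈x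
  axiom-sound σ CP4   = x◂[y◂z▸u]▸v≈[x◂y▸v]◂z▸[x◂u▸v]
  axiom-sound σ CPmem = x◂y▸[z◂u▸[v◂y▸w]]≈x◂y▸[z◂u▸w]

  g-sound : {s t : CPTerm A} → CPmem⊢ s ≈ t → EqMSCL⊢ g s ≈ g t
  g-sound (ax σ a)       = axiom-sound σ a
  g-sound refl           = refl
  g-sound (sym p)        = sym (g-sound p)
  g-sound (trans p q)    = trans (g-sound p) (g-sound q)
  g-sound (cong◁▷ p q r) = cong∨ (cong∧ q′ (g-sound p)) (cong∧ (cong¬ q′) (g-sound r))
    where q′ = g-sound q

lemma5p4 : {A : Set} → A → (s t : CPTerm A) →
    CPmem⊢ s ≈ t → EqMSCL⊢ g s ≈ g t
lemma5p4 _ _ _ = g-sound
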